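{- For disjoint finite sets $X,Y$ and $f\in\mathrm{Bool}(X\sqcup Y)$ define $\Delta_{X,Y}(f)=f_{\mid X}\otimes f_{\mid Y}\in\mathbf{Bool}(X)\otimes\mathbf{Bool}(Y)$, extended linearly. 1. For all $q_1,q_2\in\mathbb{Z}$, $(\mathbf{Bool},\star_{q_1,q_2},\Delta)$ is a cocommutative twisted bialgebra. 2. For all $q,q_1,q_2\in\mathbb{Z}$, $\theta_q$ is a twisted bialgebra isomorphism from $(\mathbf{Bool},\star_{q_1,q_2},\Delta)$ to $(\mathbf{Bool},\star_{q_1+q,q_2+q},\Delta)$.
   Context: A boolean function on a finite set $X$ is a map $f:\mathcal{P}(X)\to\mathbb{Z}$ with $f(\emptyset)=0$; $\mathrm{Bool}(X)$ is the set of them, $\mathbf{Bool}(X)$ the $\mathbb{K}$-vector space with basis $\mathrm{Bool}(X)$ ($\mathbb{K}$ a field of characteristic $0$); this is a linear species, bijections $\sigma$ acting by $f\mapsto f\circ\sigma^{ -1}$. For $Y\subseteq X$, $f_{\mid Y}$ is the restriction to $\mathcal{P}(Y)$. For disjoint $X,Y$, $f\in\mathrm{Bool}(X)$, $g\in\mathrm{Bool}(Y)$: $f\star_{q_1,q_2}g(A)=q_1^{|A\cap Y|}f(A\cap X)+q_2^{|A\cap X|}g(A\cap Y)$ for $A\subseteq X\sqcup Y$ (with $0^0=1$); the unit is the unique element $1\in\mathrm{Bool}(\emptyset)$. For $q\in\mathbb{Z}$, $\theta_q(f)(A)=\sum_{B\subseteq A}q^{|A|-|B|}f(B)$. A twisted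 bialgebra is a bialgebra in the category of linear species with the Cauchy tensor product: a twisted algebra $(\mathcal{Q},m)$ (associative, unital, equivariant maps $m_{X,Y}:\mathcal{Q}(X)\otimes\mathcal{Q}(Y)\to\mathcal{Q}(X\sqcup Y)$) and a twisted coalgebra $(\mathcal{Q},\Delta)$ (coassociative, counital, equivariant maps $\Delta_{X,Y}:\mathcal{Q}(X\sqcup Y)\to\mathcal{Q}(X)\otimes\mathcal{Q}(Y)$, with counit $\varepsilon_\Delta$ on $\mathcal{Q}(\emptyset)$), such that $\varepsilon_\Delta$ is multiplicative with $\varepsilon_\Delta(1)=1$ and, whenever $X\sqcup Y=X'\sqcup Y'$, $\Delta_{X',Y'}(m_{X,Y}(x\otimes y))=\sum m_{X\cap X',Y\cap X'}(x'\otimes y')\otimes m_{X\cap Y',Y\cap Y'}(x''\otimes y'')$ where $\Delta_{X\cap X',X\cap Y'}(x)=\sum x'\otimes x''$ and $\Delta_{Y\cap X',Y\cap Y'}(y)=\sum y'\otimes y''$. Cocommutative means $\tau\circ\Delta_{X,Y}=\Delta_{Y,X}$ with $\tau$ the flip. -}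

module Defs where

open import Level using (Level; 0ℓ; _⊔_) renaming (suc to lsuc)
open import Algebra.Bundles using (CommutativeRing)
open import Data.Bool using (Bool; true; false; if_then_else_; not; _∧_; _∨_)
open import Data.Nat as ℕ using (ℕ; zero; suc; _∸_)
open import Data.Nat.Properties using (+-assoc; +-identityʳ)
open import Data.Integer as ℤ using (ℤ; +_)
import Data.Integer.Properties as ℤP
open import Data.Fin using (Fin; splitAt; join; cast)
open import Data.Fin.Properties using (+↔⊎; cast-involutive)
open import Data.Fin.Subset using (Subset; ∣_∣) renaming (⊥ to ∅)
open import Data.Vec using (Vec; []; _∷_; replicate; tabulate; lookup; _++_)
open import Data.List using (List; []; _∷_; [_]) renaming (_++_ to _++ᴸ_; map to mapᴸ)
open import Data.Product using (Σ; ∃; _×_; _,_; proj₁; proj₂)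
import Data.Product as Prod
open import Data.Product.Relation.Binary.Pointwise.NonDependent using (×-decSetoid)
open import Data.Sum using (_⊎_; inj₁; inj₂)
open import Data.Sum.Algebra using (⊎-cong; ⊎-comm)
open import Function using (_↔_; Inverse; mk↔ₛ′; id; _∘_)
open import Function.Properties.Inverse using (↔-trans; ↔-sym)
open import Relation.Binary.Bundles using (DecSetoid)
open import Relation.Binary.PropositionalEquality using (_≡_; refl; cong; cong₂; sym; trans)
open import Relation.Nullary using (Dec; yes; no; ¬_)
open import Relation.Nullary.Decidable using (⌊_⌋)

ringFromℕ : ∀ {c ℓ} (R : CommutativeRing c ℓ) → ℕ → CommutativeRing.Carrier R
ringFromℕ R zero    = CommutativeRing.0# R
ringFromℕ R (suc n) = CommutativeRing._+_ R (CommutativeRing.1# R) (ringFromℕ R n)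

record Field (c ℓ : Level) : Set (lsuc (c ⊔ ℓ)) where
  field
    commutativeRing : CommutativeRing c ℓ
  open CommutativeRing commutativeRing
  field
    1≉0     : ¬ (1# ≈ 0#)
    inverse : ∀ x → ¬ (x ≈ 0#) → ∃ λ y → (x * y) ≈ 1#
    char0   : ∀ n → ringFromℕ commutativeRing n ≈ 0# → n ≡ 0
  open CommutativeRing commutativeRing public

-- Finite sets are (up to the species action) the sets Fin n.
-- Bijections of finite sets are Fin m ↔ Fin n.

_⊕_ : ∀ {m m' n n'} → Fin m ↔ Fin m' → Fin n ↔ Fin n' → Fin (m ℕ.+ n) ↔ Fin (m' ℕ.+ n')
σ ⊕ τ = ↔-trans +↔⊎ (↔-trans (⊎-cong σ τ) (↔-sym +↔⊎))

assocF : ∀ m n p → Fin (m ℕ.+ (n ℕ.+ p)) ↔ Fin ((m ℕ.+ n) ℕ.+ p)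
assocF m n p = mk↔ₛ′ (cast (sym (+-assoc m n p))) (cast (+-assoc m n p))
  (cast-involutive (sym (+-assoc m n p)) (+-assoc m n p))
  (cast-involutive (+-assoc m n p) (sym (+-assoc m n p)))

ridF : ∀ n → Fin n ↔ Fin (n ℕ.+ 0)
ridF n = mk↔ₛ′ (cast (sym (+-identityʳ n))) (cast (+-identityʳ n))
  (cast-involutive (sym (+-identityʳ n)) (+-identityʳ n))
  (cast-involutive (+-identityʳ n) (sym (+-identityʳ n)))

swapF : ∀ m n → Fin (m ℕ.+ n) ↔ Fin (n ℕ.+ m)
swapF m n = ↔-trans +↔⊎ (↔-trans (⊎-comm (Fin m) (Fin n)) (↔-sym +↔⊎))

module _ {A B C D : Set} where
  private
    ex : (A ⊎ B) ⊎ (C ⊎ D) → (A ⊎ C) ⊎ (B ⊎ D)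
    ex (inj₁ (inj₁ a)) = inj₁ (inj₁ a)
    ex (inj₁ (inj₂ b)) = inj₂ (inj₁ b)
    ex (inj₂ (inj₁ c)) = inj₁ (inj₂ c)
    ex (inj₂ (inj₂ d)) = inj₂ (inj₂ d)
    ex⁻ : (A ⊎ C) ⊎ (B ⊎ D) → (A ⊎ B) ⊎ (C ⊎ D)
    ex⁻ (inj₁ (inj₁ a)) = inj₁ (inj₁ a)
    ex⁻ (inj₁ (inj₂ c)) = inj₂ (inj₁ c)
    ex⁻ (inj₂ (inj₁ b)) = inj₁ (inj₂ b)
    ex⁻ (inj₂ (inj₂ d)) = inj₂ (inj₂ d)
    exl : ∀ x → ex (ex⁻ x) ≡ x
    exl (inj₁ (inj₁ a)) = refl
    exl (inj₁ (inj₂ c)) = refl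
    exl (inj₂ (inj₁ b)) = refl
    exl (inj₂ (inj₂ d)) = refl
    exr : ∀ x → ex⁻ (ex x) ≡ x
    exr (inj₁ (inj₁ a)) = refl
    exr (inj₁ (inj₂ b)) = refl
    exr (inj₂ (inj₁ c)) = refl
    exr (inj₂ (inj₂ d)) = refl
  interchange : ((A ⊎ B) ⊎ (C ⊎ D)) ↔ ((A ⊎ C) ⊎ (B ⊎ D))
  interchange = mk↔ₛ′ ex ex⁻ exl exr

mid4F : ∀ a₁ a₂ b₁ b₂ →
  Fin ((a₁ ℕ.+ a₂) ℕ.+ (b₁ ℕ.+ b₂)) ↔ Fin ((a₁ ℕ.+ b₁) ℕ.+ (a₂ ℕ.+ b₂))
mid4F a₁ a₂ b₁ b₂ =
  ↔-trans (+↔⊎ {a₁ ℕ.+ a₂} {b₁ ℕ.+ b₂})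
    (↔-trans (⊎-cong (+↔⊎ {a₁} {a₂}) (+↔⊎ {b₁} {b₂})) (↔-trans interchange
    (↔-trans (⊎-cong (↔-sym (+↔⊎ {a₁} {b₁})) (↔-sym (+↔⊎ {a₂} {b₂})))
      (↔-sym (+↔⊎ {a₁ ℕ.+ b₁} {a₂ ℕ.+ b₂})))))

-- An element of K[A] is a formal finite linear combination, i.e. a list
-- of (coefficient , basis element); two combinations are equal when all
-- their coefficients agree.  K[A] ⊗ K[B] is identified with K[A × B].

module FreeModule {c ℓ} (K : Field c ℓ) where
  open Field K renaming (Carrier to 𝕂)

  FM : Set → Set c
  FM A = List (𝕂 × A)

  coeff : (A : DecSetoid 0ℓ 0ℓ) → DecSetoid.Carrier A → FM (DecSetoid.Carrier A) → 𝕂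
  coeff A a []            = 0#
  coeff A a ((k , b) ∷ u) = (if ⌊ DecSetoid._≟_ A b a ⌋ then k else 0#) + coeff A a u

  Eq : (A : DecSetoid 0ℓ 0ℓ) → FM (DecSetoid.Carrier A) → FM (DecSetoid.Carrier A) → Set ℓ
  Eq A u v = ∀ a → coeff A a u ≈ coeff A a v

  0ᶠ : ∀ {A} → FM A
  0ᶠ = []

  _+ᶠ_ : ∀ {A} → FM A → FM A → FM A
  _+ᶠ_ = _++ᴸ_

  _·ᶠ_ : ∀ {A} → 𝕂 → FM A → FM A
  k ·ᶠ u = mapᴸ (Prod.map₁ (k *_)) u

  basis : ∀ {A} → A → FM A
  basis a = [ (1# , a) ]

  linExt : ∀ {A B} → (A → FM B) → FM A → FM B
  linExt f []            = []
  linExt f ((k , a) ∷ u) = (k ·ᶠ f a) +ᶠ linExt f u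

  linExtK : ∀ {A} → (A → 𝕂) → FM A → 𝕂
  linExtK f []            = 0#
  linExtK f ((k , a) ∷ u) = (k * f a) + linExtK f u

  mapᶠ : ∀ {A B} → (A → B) → FM A → FM B
  mapᶠ g = linExt (basis ∘ g)

  _⊗_ : ∀ {A B} → FM A → FM B → FM (A × B)
  u ⊗ v = linExt (λ a → mapᶠ (a ,_) v) u

  _⊗ᴸ_ : ∀ {A A' B B'} → (FM A → FM A') → (FM B → FM B') → FM (A × B) → FM (A' × B')
  (F ⊗ᴸ G) = linExt (λ ab → F (basis (proj₁ ab)) ⊗ G (basis (proj₂ ab)))

  record IsLinear (A B : DecSetoid 0ℓ 0ℓ)
      (F : FM (DecSetoid.Carrier A) → FM (DecSetoid.Carrier B)) : Set (c ⊔ ℓ) where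
    field
      cong-≋ : ∀ u v → Eq A u v → Eq B (F u) (F v)
      additive : ∀ u v → Eq B (F (u +ᶠ v)) (F u +ᶠ F v)
      homogeneous : ∀ k u → Eq B (F (k ·ᶠ u)) (k ·ᶠ F u)

  record IsLinearForm (A : DecSetoid 0ℓ 0ℓ)
      (F : FM (DecSetoid.Carrier A) → 𝕂) : Set (c ⊔ ℓ) where
    field
      cong-≋ : ∀ u v → Eq A u v → F u ≈ F v
      additive : ∀ u v → F (u +ᶠ v) ≈ (F u + F v)
      homogeneous : ∀ k u → F (k ·ᶠ u) ≈ (k * F u)

-- Linear species with a distinguished basis: Q(Fin n) = K[B n], the
-- action of a bijection being the linear extension of its action on
-- basis elements.

record BasedSpecies : Set₁ where
  field
    B   : ℕ → DecSetoid 0ℓ 0ℓ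
    act : ∀ {m n} → Fin m ↔ Fin n → DecSetoid.Carrier (B m) → DecSetoid.Carrier (B n)
    act-cong : ∀ {m n} (σ : Fin m ↔ Fin n) {x y} →
      DecSetoid._≈_ (B m) x y → DecSetoid._≈_ (B n) (act σ x) (act σ y)

  ⟦_⟧ : ℕ → Set
  ⟦ n ⟧ = DecSetoid.Carrier (B n)

  _⊠_ : ℕ → ℕ → DecSetoid 0ℓ 0ℓ
  m ⊠ n = ×-decSetoid (B m) (B n)

-- Twisted bialgebras (in the monoidal category of linear species with
-- the Cauchy product), for species with a basis.

module TwistedBialgebras {c ℓ} (K : Field c ℓ) (Q : BasedSpecies) where
  open Field K renaming (Carrier to 𝕂)
  open FreeModule K
  open BasedSpecies Q

  Product : Set c
  Product = ∀ m n → FM (⟦ m ⟧ × ⟦ n ⟧) → FM ⟦ m ℕ.+ n ⟧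

  Coproduct : Set c
  Coproduct = ∀ m n → FM ⟦ m ℕ.+ n ⟧ → FM (⟦ m ⟧ × ⟦ n ⟧)

  Unit : Set c
  Unit = FM ⟦ 0 ⟧

  Counit : Set c
  Counit = FM ⟦ 0 ⟧ → 𝕂

  reassoc : ∀ {X Y Z : Set} → X × (Y × Z) → (X × Y) × Z
  reassoc (x , (y , z)) = ((x , y) , z)

  shuffle4 : ∀ {X₁ X₂ Y₁ Y₂ : Set} → (X₁ × X₂) × (Y₁ × Y₂) → (X₁ × Y₁) × (X₂ × Y₂)
  shuffle4 ((x₁ , x₂) , (y₁ , y₂)) = ((x₁ , y₁) , (x₂ , y₂))

  flip× : ∀ {X Y : Set} → X × Y → Y × X
  flip× (x , y) = (y , x)

  record IsTwistedBialgebra (μ : Product) (e : Unit) (Δ : Coproduct) (ε : Counit) : Set (c ⊔ ℓ) where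
    field
      μ-linear : ∀ m n → IsLinear (m ⊠ n) (B (m ℕ.+ n)) (μ m n)
      Δ-linear : ∀ m n → IsLinear (B (m ℕ.+ n)) (m ⊠ n) (Δ m n)
      ε-linear : IsLinearForm (B 0) ε
      μ-equivariant : ∀ {m m' n n'} (σ : Fin m ↔ Fin m') (τ : Fin n ↔ Fin n')
        (u : FM (⟦ m ⟧ × ⟦ n ⟧)) →
        Eq (B (m' ℕ.+ n')) (μ m' n' (mapᶠ (Prod.map (act σ) (act τ)) u))
                           (mapᶠ (act (σ ⊕ τ)) (μ m n u))
      μ-assoc : ∀ m n p (x : FM ⟦ m ⟧) (y : FM ⟦ n ⟧) (z : FM ⟦ p ⟧) →
        Eq (B ((m ℕ.+ n) ℕ.+ p)) (μ (m ℕ.+ n) p (μ m n (x ⊗ y) ⊗ z))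
           (mapᶠ (act (assocF m n p)) (μ m (n ℕ.+ p) (x ⊗ μ n p (y ⊗ z))))
      μ-unitˡ : ∀ n (x : FM ⟦ n ⟧) → Eq (B n) (μ 0 n (e ⊗ x)) x
      μ-unitʳ : ∀ n (x : FM ⟦ n ⟧) →
        Eq (B (n ℕ.+ 0)) (μ n 0 (x ⊗ e)) (mapᶠ (act (ridF n)) x)
      Δ-equivariant : ∀ {m m' n n'} (σ : Fin m ↔ Fin m') (τ : Fin n ↔ Fin n')
        (u : FM ⟦ m ℕ.+ n ⟧) →
        Eq (m' ⊠ n') (Δ m' n' (mapᶠ (act (σ ⊕ τ)) u))
                     (mapᶠ (Prod.map (act σ) (act τ)) (Δ m n u))
      Δ-coassoc : ∀ m n p (u : FM ⟦ (m ℕ.+ n) ℕ.+ p ⟧) →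
        Eq (×-decSetoid (m ⊠ n) (B p))
           ((Δ m n ⊗ᴸ id) (Δ (m ℕ.+ n) p u))
           (mapᶠ reassoc ((id ⊗ᴸ Δ n p) (Δ m (n ℕ.+ p) (mapᶠ (act (↔-sym (assocF m n p))) u))))
      Δ-counitˡ : ∀ n (u : FM ⟦ n ⟧) →
        Eq (B n) (linExt (λ ab → ε (basis (proj₁ ab)) ·ᶠ basis (proj₂ ab)) (Δ 0 n u)) u
      Δ-counitʳ : ∀ n (u : FM ⟦ n ⟧) →
        Eq (B n) (linExt (λ ab → ε (basis (proj₂ ab)) ·ᶠ basis (proj₁ ab))
                   (Δ n 0 (mapᶠ (act (ridF n)) u))) u
      ε-multiplicative : ∀ (x y : FM ⟦ 0 ⟧) → ε (μ 0 0 (x ⊗ y)) ≈ (ε x * ε y)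
      ε-unit : ε e ≈ 1#
      Δμ-compatible : ∀ a₁ a₂ b₁ b₂ (x : FM ⟦ a₁ ℕ.+ a₂ ⟧) (y : FM ⟦ b₁ ℕ.+ b₂ ⟧) →
        Eq ((a₁ ℕ.+ b₁) ⊠ (a₂ ℕ.+ b₂))
           (Δ (a₁ ℕ.+ b₁) (a₂ ℕ.+ b₂)
              (mapᶠ (act (mid4F a₁ a₂ b₁ b₂)) (μ (a₁ ℕ.+ a₂) (b₁ ℕ.+ b₂) (x ⊗ y))))
           ((μ a₁ b₁ ⊗ᴸ μ a₂ b₂) (mapᶠ shuffle4 (Δ a₁ a₂ x ⊗ Δ b₁ b₂ y)))

  record IsCocommutativeTwistedBialgebra (μ : Product) (e : Unit) (Δ : Coproduct) (ε : Counit) : Set (c ⊔ ℓ) where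
    field
      isTwistedBialgebra : IsTwistedBialgebra μ e Δ ε
      cocommutative : ∀ m n (u : FM ⟦ m ℕ.+ n ⟧) →
        Eq (n ⊠ m) (Δ n m (mapᶠ (act (swapF m n)) u)) (mapᶠ flip× (Δ m n u))

  record IsTwistedBialgebraIso (μ : Product) (e : Unit) (Δ : Coproduct) (ε : Counit)
      (μ' : Product) (e' : Unit) (Δ' : Coproduct) (ε' : Counit)
      (Φ : ∀ n → FM ⟦ n ⟧ → FM ⟦ n ⟧) : Set (c ⊔ ℓ) where
    field
      Φ-linear : ∀ n → IsLinear (B n) (B n) (Φ n)
      Φ-equivariant : ∀ {m n} (σ : Fin m ↔ Fin n) (u : FM ⟦ m ⟧) →
        Eq (B n) (Φ n (mapᶠ (act σ) u)) (mapᶠ (act σ) (Φ m u))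
      Φ-injective : ∀ n (u v : FM ⟦ n ⟧) → Eq (B n) (Φ n u) (Φ n v) → Eq (B n) u v
      Φ-surjective : ∀ n (v : FM ⟦ n ⟧) → ∃ λ u → Eq (B n) (Φ n u) v
      Φ-μ : ∀ m n (x : FM ⟦ m ⟧) (y : FM ⟦ n ⟧) →
        Eq (B (m ℕ.+ n)) (Φ (m ℕ.+ n) (μ m n (x ⊗ y))) (μ' m n (Φ m x ⊗ Φ n y))
      Φ-unit : Eq (B 0) (Φ 0 e) e'
      Φ-Δ : ∀ m n (u : FM ⟦ m ℕ.+ n ⟧) →
        Eq (m ⊠ n) (Δ' m n (Φ (m ℕ.+ n) u)) ((Φ m ⊗ᴸ Φ n) (Δ m n u))
      Φ-ε : ∀ (u : FM ⟦ 0 ⟧) → ε' (Φ 0 u) ≈ ε u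

-- Boolean functions on Fin n : maps P(Fin n) → ℤ vanishing on ∅.
-- Subsets of Fin n are Data.Fin.Subset (characteristic vectors).

record BoolFn (n : ℕ) : Set where
  constructor mkBool
  field
    fn   : Subset n → ℤ
    fn-∅ : fn ∅ ≡ + 0
open BoolFn public

allSubsets? : ∀ n (P : Subset n → Set) → (∀ A → Dec (P A)) → Dec (∀ A → P A)
allSubsets? zero P d with d []
... | yes p = yes λ { [] → p }
... | no ¬p = no λ h → ¬p (h [])
allSubsets? (suc n) P d
  with allSubsets? n (λ A → P (false ∷ A)) (λ A → d (false ∷ A))
     | allSubsets? n (λ A → P (true ∷ A)) (λ A → d (true ∷ A))
... | yes p | yes q = yes λ { (false ∷ A) → p A ; (true ∷ A) → q A }
... | no ¬p | _     = no λ h → ¬p (λ A → h (false ∷ A))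
... | yes _ | no ¬q = no λ h → ¬q (λ A → h (true ∷ A))

BoolSetoid : ℕ → DecSetoid 0ℓ 0ℓ
BoolSetoid n = record
  { Carrier = BoolFn n
  ; _≈_ = λ f g → ∀ A → fn f A ≡ fn g A
  ; isDecEquivalence = record
    { isEquivalence = record
      { refl = λ A → refl
      ; sym = λ p A → sym (p A)
      ; trans = λ p q A → trans (p A) (q A) }
    ; _≟_ = λ f g → allSubsets? n _ (λ A → fn f A ℤ.≟ fn g A) } }

private
  tabulate-false : ∀ {m} (g : Fin m → Bool) → (∀ i → g i ≡ false) → tabulate g ≡ replicate m false
  tabulate-false {zero} g h = refl
  tabulate-false {suc m} g h rewrite h Fin.zero = cong (false ∷_) (tabulate-false (g ∘ Fin.suc) (h ∘ Fin.suc))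
    where import Data.Fin as Fin

  lookup-false : ∀ {n} (i : Fin n) → lookup (replicate n false) i ≡ false
  lookup-false Fin.zero = refl
  lookup-false (Fin.suc i) = lookup-false i
    where import Data.Fin as Fin

preimage : ∀ {m n} → (Fin m → Fin n) → Subset n → Subset m
preimage s A = tabulate (λ i → lookup A (s i))

preimage-∅ : ∀ {m n} (s : Fin m → Fin n) → preimage s ∅ ≡ ∅
preimage-∅ s = tabulate-false _ (λ i → lookup-false (s i))

actBool : ∀ {m n} → Fin m ↔ Fin n → BoolFn m → BoolFn n
actBool σ f = mkBool (λ A → fn f (preimage (Inverse.to σ) A))
  (trans (cong (fn f) (preimage-∅ (Inverse.to σ))) (fn-∅ f))

BoolSp : BasedSpecies
BoolSp = record
  { B = BoolSetoid
  ; act = actBool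
  ; act-cong = λ σ p A → p (preimage (Inverse.to σ) A) }

front : ∀ m {n} → Subset (m ℕ.+ n) → Subset m
front zero    A       = []
front (suc m) (x ∷ A) = x ∷ front m A

back : ∀ m {n} → Subset (m ℕ.+ n) → Subset n
back zero    A       = A
back (suc m) (x ∷ A) = back m A

private
  front-∅ : ∀ m {n} → front m {n} ∅ ≡ ∅
  front-∅ zero = refl
  front-∅ (suc m) = cong (false ∷_) (front-∅ m)

  back-∅ : ∀ m {n} → back m {n} ∅ ≡ ∅
  back-∅ zero = refl
  back-∅ (suc m) = back-∅ m

  ++-∅ : ∀ m {n} → replicate m false ++ replicate n false ≡ ∅
  ++-∅ zero = refl
  ++-∅ (suc m) = cong (false ∷_) (++-∅ m)

restrictˡ : ∀ m {n} → BoolFn (m ℕ.+ n) → BoolFn m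
restrictˡ m {n} f = mkBool (λ A → fn f (A ++ replicate n false))
  (trans (cong (fn f) (++-∅ m)) (fn-∅ f))

restrictʳ : ∀ m {n} → BoolFn (m ℕ.+ n) → BoolFn n
restrictʳ m {n} f = mkBool (λ A → fn f (replicate m false ++ A))
  (trans (cong (fn f) (++-∅ m)) (fn-∅ f))

starFn : ℤ → ℤ → ∀ {m n} → BoolFn m → BoolFn n → Subset (m ℕ.+ n) → ℤ
starFn q₁ q₂ {m} f g A =
  (q₁ ℤ.^ ∣ back m A ∣) ℤ.* fn f (front m A) ℤ.+ (q₂ ℤ.^ ∣ front m A ∣) ℤ.* fn g (back m A)

starFn-∅ : ∀ q₁ q₂ {m n} (f : BoolFn m) (g : BoolFn n) → starFn q₁ q₂ f g ∅ ≡ + 0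
starFn-∅ q₁ q₂ {m} {n} f g
  rewrite front-∅ m {n} | back-∅ m {n} | fn-∅ f | fn-∅ g
  = cong₂ ℤ._+_ (ℤP.*-zeroʳ (q₁ ℤ.^ ∣ replicate n false ∣))
                (ℤP.*-zeroʳ (q₂ ℤ.^ ∣ replicate m false ∣))

star : ℤ → ℤ → ∀ {m n} → BoolFn m → BoolFn n → BoolFn (m ℕ.+ n)
star q₁ q₂ f g = mkBool (starFn q₁ q₂ f g) (starFn-∅ q₁ q₂ f g)

oneBool : BoolFn 0
oneBool = mkBool (λ _ → + 0) refl

sumSubsets : ∀ n → (Subset n → ℤ) → ℤ
sumSubsets zero h    = h []
sumSubsets (suc n) h = sumSubsets n (λ B → h (false ∷ B)) ℤ.+ sumSubsets n (λ B → h (true ∷ B))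

_⊆ᵇ_ : ∀ {n} → Subset n → Subset n → Bool
[] ⊆ᵇ [] = true
(b ∷ B) ⊆ᵇ (a ∷ A) = (not b ∨ a) ∧ (B ⊆ᵇ A)

thetaFn : ℤ → ∀ {n} → BoolFn n → Subset n → ℤ
thetaFn q {n} f A =
  sumSubsets n (λ B → if B ⊆ᵇ A then (q ℤ.^ (∣ A ∣ ∸ ∣ B ∣)) ℤ.* fn f B else + 0)

private
  sum-zero : ∀ n → sumSubsets n (λ _ → + 0) ≡ + 0
  sum-zero zero = refl
  sum-zero (suc n) rewrite sum-zero n = refl

  sum-⊆∅ : ∀ n (h : Subset n → ℤ) →
    sumSubsets n (λ B → if B ⊆ᵇ ∅ then h B else + 0) ≡ h ∅
  sum-⊆∅ zero h = refl
  sum-⊆∅ (suc n) h rewrite sum-⊆∅ n (λ B → h (false ∷ B)) | sum-zero n =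
    ℤP.+-identityʳ (h (false ∷ ∅))

thetaFn-∅ : ∀ q {n} (f : BoolFn n) → thetaFn q f ∅ ≡ + 0
thetaFn-∅ q {n} f =
  trans (sum-⊆∅ n (λ B → (q ℤ.^ (∣ ∅ {n} ∣ ∸ ∣ B ∣)) ℤ.* fn f B))
        (trans (cong ((q ℤ.^ (∣ ∅ {n} ∣ ∸ ∣ ∅ {n} ∣)) ℤ.*_) (fn-∅ f)) (ℤP.*-zeroʳ (q ℤ.^ (∣ ∅ {n} ∣ ∸ ∣ ∅ {n} ∣))))

theta : ℤ → ∀ {n} → BoolFn n → BoolFn n
theta q f = mkBool (thetaFn q f) (thetaFn-∅ q f)

module BoolBialgebra {c ℓ} (K : Field c ℓ) where
  open Field K renaming (Carrier to 𝕂)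
  open FreeModule K

  starᴸ : ℤ → ℤ → ∀ m n → FM (BoolFn m × BoolFn n) → FM (BoolFn (m ℕ.+ n))
  starᴸ q₁ q₂ m n = linExt (λ fg → basis (star q₁ q₂ (proj₁ fg) (proj₂ fg)))

  unitᴸ : FM (BoolFn 0)
  unitᴸ = basis oneBool

  Δᴸ : ∀ m n → FM (BoolFn (m ℕ.+ n)) → FM (BoolFn m × BoolFn n)
  Δᴸ m n = linExt (λ f → basis (restrictˡ m f , restrictʳ m f))

  εᴸ : FM (BoolFn 0) → 𝕂
  εᴸ = linExtK (λ _ → 1#)

  thetaᴸ : ℤ → ∀ n → FM (BoolFn n) → FM (BoolFn n)
  thetaᴸ q n = linExt (λ f → basis (theta q f))

module Submission where

-- Every structure map of 𝐁𝐨𝐨𝐥 is the linear extension mapᶠ g of a map g on basis elements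
-- (products, restrictions, relabellings, θ_q), and mapᶠ g u and mapᶠ g′ u have the same coefficients
-- as soon as g and g′ agree pointwise up to equality of Boolean functions.  Comparing vectors through
-- all linear forms ⟪ φ ⟫ = linExtK φ brings both sides of every axiom into this shape, so the axioms
-- reduce to identities between Boolean functions.  These are checked on subsets A = X ++ Y split
-- along X ⊔ Y, on which the relabelling bijections act blockwise.  The substantial identity is
-- θ_q (f ⋆ g) = θ_q f ⋆′ θ_q g: in the recursive form zeta, θ_q is multiplicative on functions
-- u (A ∩ X) · v (A ∩ Y) and sends A ↦ c ^ ∣A∣ to A ↦ (c + q) ^ ∣A∣.  Finally θ_{-q} inverts θ_q, and
-- θ_q commutes with relabelling because its defining sum over all subsets can be reindexed along the
-- induced bijection of power sets.

open import Defs
import Algebra.Properties.CommutativeMonoid.Sum as MonoidSum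
open import Level using (0ℓ; _⊔_)
open import Data.Bool using (Bool; true; false; not; _∧_; _∨_; if_then_else_)
import Data.Bool.Properties as Bool
open import Data.Empty using (⊥; ⊥-elim)
open import Data.Nat as ℕ using (ℕ; zero; suc; _≤_; _∸_)
import Data.Nat.Properties as ℕ
import Data.Integer as ℤ
import Data.Integer.Properties as ℤP
open import Data.Integer.Tactic.RingSolver using (solve-∀)
open import Data.Fin as Fin using (Fin; join; splitAt)
open import Data.Fin.Subset using (Subset; ∣_∣) renaming (⊥ to ∅)
open import Data.Fin.Subset.Properties using (∣⊥∣≡0)
open import Data.Vec as Vec using ([]; _∷_; _++_; lookup)
open import Data.Vec.Properties using
  (lookup∘tabulate; tabulate∘lookup; tabulate-cong; lookup-++ˡ; lookup-++ʳ; lookup-splitAt;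
   lookup-cast₂; ++-assoc-eqFree; ++-identityʳ-eqFree; cast-sym; ∷-injectiveʳ)
open import Data.List as List using (List; []; _∷_; map; foldr; length; filter) renaming (_++_ to _++ᴸ_)
import Data.List.Properties as List
open import Data.List.Membership.Propositional using (_∈_)
open import Data.List.Membership.Propositional.Properties using (∈-map⁺; ∈-map⁻; ∈-++⁺ˡ; ∈-++⁺ʳ)
open import Data.List.Membership.Propositional.Properties.WithK using (unique∧set⇒bag)
open import Data.List.Relation.Binary.BagAndSetEquality using (∼bag⇒↭)
open import Data.List.Relation.Binary.Permutation.Propositional using (_↭_; ↭⇒↭ₛ)
import Data.List.Relation.Binary.Permutation.Propositional.Properties as ↭
import Data.List.Relation.Binary.Permutation.Setoid.Properties as ↭ₛ
open import Data.List.Relation.Unary.Any using (here)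
import Data.List.Relation.Unary.All as All
import Data.List.Relation.Unary.AllPairs as AllPairs
open import Data.List.Relation.Unary.Unique.Propositional using (Unique)
import Data.List.Relation.Unary.Unique.Propositional.Properties as Unique
open import Data.Product as Prod using (_×_; _,_; proj₁; proj₂; uncurry)
open import Data.Product.Relation.Binary.Pointwise.NonDependent using (Pointwise; ×-decSetoid)
open import Data.Sum as Sum using (_⊎_; inj₁; inj₂; [_,_]′)
open import Function using (_∘_; id; const; _↔_; Inverse; Injection; mk↔ₛ′; mk⇔)
open import Function.Properties.Inverse using (↔-sym; ↔⇒↣)
open import Relation.Binary.Bundles using (DecSetoid)
open import Relation.Binary.Core using (_Preserves_⟶_)
import Relation.Binary.PropositionalEquality as ≡
import Relation.Binary.Reasoning.Setoid as SetoidReasoning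
open import Relation.Nullary using (¬_; yes; no; ¬?)
open import Relation.Nullary.Decidable using (⌊_⌋)

module LinearForms {c ℓ} (K : Field c ℓ) where
  open Field K renaming (Carrier to 𝕂)
  open FreeModule K
  open SetoidReasoning setoid
  open import Algebra.Solver.Ring.NaturalCoefficients.Default commutativeSemiring

  private variable
    A B C : Set

  ⟪_⟫ : (A → 𝕂) → FM A → 𝕂
  ⟪_⟫ = linExtK

  ⟪⟫-+ᶠ : ∀ (φ : A → 𝕂) u v → ⟪ φ ⟫ (u +ᶠ v) ≈ ⟪ φ ⟫ u + ⟪ φ ⟫ v
  ⟪⟫-+ᶠ φ []            v = sym (+-identityˡ _)
  ⟪⟫-+ᶠ φ ((k , a) ∷ u) v = trans (+-congˡ (⟪⟫-+ᶠ φ u v)) (sym (+-assoc _ _ _))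

  ⟪⟫-·ᶠ : ∀ (φ : A → 𝕂) k u → ⟪ φ ⟫ (k ·ᶠ u) ≈ k * ⟪ φ ⟫ u
  ⟪⟫-·ᶠ φ k []             = sym (zeroʳ k)
  ⟪⟫-·ᶠ φ k ((k′ , a) ∷ u) = trans (+-cong (*-assoc _ _ _) (⟪⟫-·ᶠ φ k u)) (sym (distribˡ k _ _))

  ⟪⟫-cong : ∀ {φ ψ : A → 𝕂} → (∀ a → φ a ≈ ψ a) → ∀ u → ⟪ φ ⟫ u ≈ ⟪ ψ ⟫ u
  ⟪⟫-cong φ≈ψ []            = refl
  ⟪⟫-cong φ≈ψ ((k , a) ∷ u) = +-cong (*-congˡ (φ≈ψ a)) (⟪⟫-cong φ≈ψ u)

  ⟪⟫-*ʳ : ∀ (φ : A → 𝕂) x u → ⟪ (λ a → φ a * x) ⟫ u ≈ ⟪ φ ⟫ u * x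
  ⟪⟫-*ʳ φ x []            = sym (zeroˡ x)
  ⟪⟫-*ʳ φ x ((k , a) ∷ u) =
    trans (+-cong (sym (*-assoc k (φ a) x)) (⟪⟫-*ʳ φ x u)) (sym (distribʳ x _ _))

  ⟪⟫-basis : ∀ (φ : A → 𝕂) a → ⟪ φ ⟫ (basis a) ≈ φ a
  ⟪⟫-basis φ a = trans (+-identityʳ _) (*-identityˡ _)

  ⟪⟫-linExt : ∀ (φ : B → 𝕂) (h : A → FM B) u → ⟪ φ ⟫ (linExt h u) ≈ ⟪ ⟪ φ ⟫ ∘ h ⟫ u
  ⟪⟫-linExt φ h []            = refl
  ⟪⟫-linExt φ h ((k , a) ∷ u) =
    trans (⟪⟫-+ᶠ φ (k ·ᶠ h a) (linExt h u)) (+-cong (⟪⟫-·ᶠ φ k (h a)) (⟪⟫-linExt φ h u))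

  ⟪⟫-mapᶠ : ∀ (φ : B → 𝕂) (g : A → B) u → ⟪ φ ⟫ (mapᶠ g u) ≈ ⟪ φ ∘ g ⟫ u
  ⟪⟫-mapᶠ φ g u = trans (⟪⟫-linExt φ (basis ∘ g) u) (⟪⟫-cong (⟪⟫-basis φ ∘ g) u)

  ⟪⟫-⊗ : ∀ (φ : A × B → 𝕂) u v → ⟪ φ ⟫ (u ⊗ v) ≈ ⟪ (λ a → ⟪ (λ b → φ (a , b)) ⟫ v) ⟫ u
  ⟪⟫-⊗ φ u v = trans (⟪⟫-linExt φ (λ a → mapᶠ (a ,_) v) u) (⟪⟫-cong (λ a → ⟪⟫-mapᶠ φ (a ,_) v) u)

  ⟪1⟫-⊗ : ∀ (u : FM A) (v : FM B) → ⟪ const 1# ⟫ (u ⊗ v) ≈ ⟪ const 1# ⟫ u * ⟪ const 1# ⟫ v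
  ⟪1⟫-⊗ u v = begin
    ⟪ const 1# ⟫ (u ⊗ v)               ≈⟨ ⟪⟫-⊗ (const 1#) u v ⟩
    ⟪ const (⟪ const 1# ⟫ v) ⟫ u       ≈⟨ ⟪⟫-cong (λ _ → *-identityˡ (⟪ const 1# ⟫ v)) u ⟨
    ⟪ (λ _ → 1# * ⟪ const 1# ⟫ v) ⟫ u  ≈⟨ ⟪⟫-*ʳ (const 1#) (⟪ const 1# ⟫ v) u ⟩
    ⟪ const 1# ⟫ u * ⟪ const 1# ⟫ v    ∎

  -- Unlike Eq, weak equality needs no setoid on A, so it also relates the intermediate tensor
  -- expressions.
  infix 4 _≋_
  record _≋_ (u v : FM A) : Set (c ⊔ ℓ) where
    constructor mk≋
    field agree : ∀ φ → ⟪ φ ⟫ u ≈ ⟪ φ ⟫ v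
  open _≋_ public

  ≋-refl : ∀ {u : FM A} → u ≋ u
  ≋-refl = mk≋ λ φ → refl

  ≋-sym : ∀ {u v : FM A} → u ≋ v → v ≋ u
  ≋-sym u≋v = mk≋ λ φ → sym (agree u≋v φ)

  ≋-trans : ∀ {u v w : FM A} → u ≋ v → v ≋ w → u ≋ w
  ≋-trans u≋v v≋w = mk≋ λ φ → trans (agree u≋v φ) (agree v≋w φ)

  mapᶠ-cong : ∀ (g : A → B) {u v} → u ≋ v → mapᶠ g u ≋ mapᶠ g v
  mapᶠ-cong g {u} {v} u≋v = mk≋ λ φ → begin
    ⟪ φ ⟫ (mapᶠ g u) ≈⟨ ⟪⟫-mapᶠ φ g u ⟩
    ⟪ φ ∘ g ⟫ u      ≈⟨ agree u≋v (φ ∘ g) ⟩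
    ⟪ φ ∘ g ⟫ v      ≈⟨ ⟪⟫-mapᶠ φ g v ⟨
    ⟪ φ ⟫ (mapᶠ g v) ∎

  mapᶠ-∘ : ∀ (g : B → C) (h : A → B) u → mapᶠ g (mapᶠ h u) ≋ mapᶠ (g ∘ h) u
  mapᶠ-∘ g h u = mk≋ λ φ → begin
    ⟪ φ ⟫ (mapᶠ g (mapᶠ h u)) ≈⟨ ⟪⟫-mapᶠ φ g (mapᶠ h u) ⟩
    ⟪ φ ∘ g ⟫ (mapᶠ h u)      ≈⟨ ⟪⟫-mapᶠ (φ ∘ g) h u ⟩
    ⟪ φ ∘ g ∘ h ⟫ u           ≈⟨ ⟪⟫-mapᶠ φ (g ∘ h) u ⟨
    ⟪ φ ⟫ (mapᶠ (g ∘ h) u)    ∎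

  mapᶠ-id : ∀ (u : FM A) → mapᶠ id u ≋ u
  mapᶠ-id u = mk≋ λ φ → ⟪⟫-mapᶠ φ id u

  mapᶠ-basis : ∀ (g : A → B) a → mapᶠ g (basis a) ≋ basis (g a)
  mapᶠ-basis g a = mk≋ λ φ →
    trans (⟪⟫-mapᶠ φ g (basis a)) (trans (⟪⟫-basis (φ ∘ g) a) (sym (⟪⟫-basis φ (g a))))

  ⊗-cong : ∀ {u u′ : FM A} {v v′ : FM B} → u ≋ u′ → v ≋ v′ → u ⊗ v ≋ u′ ⊗ v′
  ⊗-cong {u = u} {u′} {v} {v′} u≋u′ v≋v′ = mk≋ λ φ → begin
    ⟪ φ ⟫ (u ⊗ v)                                ≈⟨ ⟪⟫-⊗ φ u v ⟩
    ⟪ (λ a → ⟪ (λ b → φ (a , b)) ⟫ v) ⟫ u        ≈⟨ ⟪⟫-cong (λ a → agree v≋v′ (λ b → φ (a , b))) u ⟩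
    ⟪ (λ a → ⟪ (λ b → φ (a , b)) ⟫ v′) ⟫ u       ≈⟨ agree u≋u′ (λ a → ⟪ (λ b → φ (a , b)) ⟫ v′) ⟩
    ⟪ (λ a → ⟪ (λ b → φ (a , b)) ⟫ v′) ⟫ u′      ≈⟨ ⟪⟫-⊗ φ u′ v′ ⟨
    ⟪ φ ⟫ (u′ ⊗ v′)                              ∎

  mapᶠ-⊗ : ∀ {A′ B′ : Set} (f : A → A′) (g : B → B′) u v →
    mapᶠ f u ⊗ mapᶠ g v ≋ mapᶠ (Prod.map f g) (u ⊗ v)
  mapᶠ-⊗ f g u v = mk≋ λ φ → begin
    ⟪ φ ⟫ (mapᶠ f u ⊗ mapᶠ g v)                            ≈⟨ ⟪⟫-⊗ φ (mapᶠ f u) (mapᶠ g v) ⟩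
    ⟪ (λ a → ⟪ (λ b → φ (a , b)) ⟫ (mapᶠ g v)) ⟫ (mapᶠ f u) ≈⟨ ⟪⟫-mapᶠ _ f u ⟩
    ⟪ (λ a → ⟪ (λ b → φ (f a , b)) ⟫ (mapᶠ g v)) ⟫ u        ≈⟨ ⟪⟫-cong (λ a → ⟪⟫-mapᶠ _ g v) u ⟩
    ⟪ (λ a → ⟪ (λ b → φ (f a , g b)) ⟫ v) ⟫ u               ≈⟨ ⟪⟫-⊗ (φ ∘ Prod.map f g) u v ⟨
    ⟪ φ ∘ Prod.map f g ⟫ (u ⊗ v)                            ≈⟨ ⟪⟫-mapᶠ φ (Prod.map f g) (u ⊗ v) ⟨
    ⟪ φ ⟫ (mapᶠ (Prod.map f g) (u ⊗ v))                     ∎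

  mapᶠ-cong-∘ : ∀ (g : B → C) (h : A → B) w {u} → u ≋ mapᶠ h w → mapᶠ g u ≋ mapᶠ (g ∘ h) w
  mapᶠ-cong-∘ g h w u≋hw = ≋-trans (mapᶠ-cong g u≋hw) (mapᶠ-∘ g h w)

  mapᶠ-⊗ˡ : ∀ {A′ : Set} (f : A → A′) u (v : FM B) → mapᶠ f u ⊗ v ≋ mapᶠ (Prod.map₁ f) (u ⊗ v)
  mapᶠ-⊗ˡ f u v = ≋-trans (⊗-cong (≋-refl {u = mapᶠ f u}) (≋-sym (mapᶠ-id v))) (mapᶠ-⊗ f id u v)

  mapᶠ-⊗ʳ : ∀ {B′ : Set} (g : B → B′) (u : FM A) v → u ⊗ mapᶠ g v ≋ mapᶠ (Prod.map₂ g) (u ⊗ v)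
  mapᶠ-⊗ʳ g u v = ≋-trans (⊗-cong (≋-sym (mapᶠ-id u)) (≋-refl {u = mapᶠ g v})) (mapᶠ-⊗ id g u v)

  ⊗-assoc : ∀ {C : Set} (u : FM A) (v : FM B) (w : FM C) →
    (u ⊗ v) ⊗ w ≋ mapᶠ Prod.assocˡ′ (u ⊗ (v ⊗ w))
  ⊗-assoc u v w = mk≋ λ φ → begin
    ⟪ φ ⟫ ((u ⊗ v) ⊗ w)
      ≈⟨ ⟪⟫-⊗ φ (u ⊗ v) w ⟩
    ⟪ (λ ab → ⟪ (λ c → φ (ab , c)) ⟫ w) ⟫ (u ⊗ v)
      ≈⟨ ⟪⟫-⊗ _ u v ⟩
    ⟪ (λ a → ⟪ (λ b → ⟪ (λ c → φ ((a , b) , c)) ⟫ w) ⟫ v) ⟫ u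
      ≈⟨ ⟪⟫-cong (λ a → ⟪⟫-⊗ _ v w) u ⟨
    ⟪ (λ a → ⟪ (λ bc → φ (Prod.assocˡ′ (a , bc))) ⟫ (v ⊗ w)) ⟫ u
      ≈⟨ ⟪⟫-⊗ _ u (v ⊗ w) ⟨
    ⟪ φ ∘ Prod.assocˡ′ ⟫ (u ⊗ (v ⊗ w))
      ≈⟨ ⟪⟫-mapᶠ φ Prod.assocˡ′ (u ⊗ (v ⊗ w)) ⟨
    ⟪ φ ⟫ (mapᶠ Prod.assocˡ′ (u ⊗ (v ⊗ w))) ∎

  basis-⊗ : ∀ (a : A) (v : FM B) → basis a ⊗ v ≋ mapᶠ (a ,_) v
  basis-⊗ a v = mk≋ λ φ → begin
    ⟪ φ ⟫ (basis a ⊗ v)                                ≈⟨ ⟪⟫-⊗ φ (basis a) v ⟩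
    ⟪ (λ a′ → ⟪ (λ b → φ (a′ , b)) ⟫ v) ⟫ (basis a)     ≈⟨ ⟪⟫-basis (λ a′ → ⟪ (λ b → φ (a′ , b)) ⟫ v) a ⟩
    ⟪ (λ b → φ (a , b)) ⟫ v                             ≈⟨ ⟪⟫-mapᶠ φ (a ,_) v ⟨
    ⟪ φ ⟫ (mapᶠ (a ,_) v)                               ∎

  ⊗-basis : ∀ (u : FM A) (b : B) → u ⊗ basis b ≋ mapᶠ (_, b) u
  ⊗-basis u b = mk≋ λ φ → begin
    ⟪ φ ⟫ (u ⊗ basis b)                                ≈⟨ ⟪⟫-⊗ φ u (basis b) ⟩
    ⟪ (λ a → ⟪ (λ b′ → φ (a , b′)) ⟫ (basis b)) ⟫ u     ≈⟨ ⟪⟫-cong (λ a → ⟪⟫-basis (λ b′ → φ (a , b′)) b) u ⟩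
    ⟪ (λ a → φ (a , b)) ⟫ u                             ≈⟨ ⟪⟫-mapᶠ φ (_, b) u ⟨
    ⟪ φ ⟫ (mapᶠ (_, b) u)                               ∎

  ⊗ᴸ-mapᶠ : ∀ {A′ B′ : Set} (F : FM A → FM A′) (G : FM B → FM B′) (f : A → A′) (g : B → B′) →
    (∀ a → F (basis a) ≋ basis (f a)) → (∀ b → G (basis b) ≋ basis (g b)) →
    ∀ w → (F ⊗ᴸ G) w ≋ mapᶠ (Prod.map f g) w
  ⊗ᴸ-mapᶠ F G f g F≋f G≋g w = mk≋ λ φ → begin
    ⟪ φ ⟫ ((F ⊗ᴸ G) w)
      ≈⟨ ⟪⟫-linExt φ (λ ab → F (basis (proj₁ ab)) ⊗ G (basis (proj₂ ab))) w ⟩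
    ⟪ (λ ab → ⟪ φ ⟫ (F (basis (proj₁ ab)) ⊗ G (basis (proj₂ ab)))) ⟫ w
        ≈⟨ ⟪⟫-cong (λ (a , b) → agree (⊗-cong (F≋f a) (G≋g b)) φ) w ⟩
    ⟪ (λ ab → ⟪ φ ⟫ (basis (f (proj₁ ab)) ⊗ basis (g (proj₂ ab)))) ⟫ w
        ≈⟨ ⟪⟫-cong (λ (a , b) → agree (≋-trans (basis-⊗ (f a) (basis (g b))) (mapᶠ-basis (f a ,_) (g b))) φ) w ⟩
    ⟪ (λ ab → ⟪ φ ⟫ (basis (Prod.map f g ab))) ⟫ w
      ≈⟨ ⟪⟫-cong (λ ab → ⟪⟫-basis φ (Prod.map f g ab)) w ⟩
    ⟪ φ ∘ Prod.map f g ⟫ w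
      ≈⟨ ⟪⟫-mapᶠ φ (Prod.map f g) w ⟨
    ⟪ φ ⟫ (mapᶠ (Prod.map f g) w) ∎

  linExt-·basis : ∀ (k : A → 𝕂) (g : A → B) → (∀ a → k a ≈ 1#) →
    ∀ w → linExt (λ a → k a ·ᶠ basis (g a)) w ≋ mapᶠ g w
  linExt-·basis k g k≈1 w = mk≋ λ φ → begin
    ⟪ φ ⟫ (linExt (λ a → k a ·ᶠ basis (g a)) w)
      ≈⟨ ⟪⟫-linExt φ (λ a → k a ·ᶠ basis (g a)) w ⟩
    ⟪ (λ a → ⟪ φ ⟫ (k a ·ᶠ basis (g a))) ⟫ w
      ≈⟨ ⟪⟫-cong (λ a → ⟪⟫-·ᶠ φ (k a) (basis (g a))) w ⟩
    ⟪ (λ a → k a * ⟪ φ ⟫ (basis (g a))) ⟫ w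
      ≈⟨ ⟪⟫-cong (λ a → *-cong (k≈1 a) (⟪⟫-basis φ (g a))) w ⟩
    ⟪ (λ a → 1# * φ (g a)) ⟫ w
      ≈⟨ ⟪⟫-cong (λ a → *-identityˡ (φ (g a))) w ⟩
    ⟪ φ ∘ g ⟫ w
      ≈⟨ ⟪⟫-mapᶠ φ g w ⟨
    ⟪ φ ⟫ (mapᶠ g w) ∎

  mapᶠ-+ᶠ : ∀ (g : A → B) u v → mapᶠ g (u +ᶠ v) ≋ mapᶠ g u +ᶠ mapᶠ g v
  mapᶠ-+ᶠ g u v = mk≋ λ φ → begin
    ⟪ φ ⟫ (mapᶠ g (u +ᶠ v))                 ≈⟨ ⟪⟫-mapᶠ φ g (u +ᶠ v) ⟩
    ⟪ φ ∘ g ⟫ (u +ᶠ v)                      ≈⟨ ⟪⟫-+ᶠ (φ ∘ g) u v ⟩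
    ⟪ φ ∘ g ⟫ u + ⟪ φ ∘ g ⟫ v               ≈⟨ +-cong (⟪⟫-mapᶠ φ g u) (⟪⟫-mapᶠ φ g v) ⟨
    ⟪ φ ⟫ (mapᶠ g u) + ⟪ φ ⟫ (mapᶠ g v)     ≈⟨ ⟪⟫-+ᶠ φ (mapᶠ g u) (mapᶠ g v) ⟨
    ⟪ φ ⟫ (mapᶠ g u +ᶠ mapᶠ g v)            ∎

  mapᶠ-·ᶠ : ∀ (g : A → B) k u → mapᶠ g (k ·ᶠ u) ≋ k ·ᶠ mapᶠ g u
  mapᶠ-·ᶠ g k u = mk≋ λ φ → begin
    ⟪ φ ⟫ (mapᶠ g (k ·ᶠ u))    ≈⟨ ⟪⟫-mapᶠ φ g (k ·ᶠ u) ⟩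
    ⟪ φ ∘ g ⟫ (k ·ᶠ u)         ≈⟨ ⟪⟫-·ᶠ (φ ∘ g) k u ⟩
    k * ⟪ φ ∘ g ⟫ u            ≈⟨ *-congˡ (⟪⟫-mapᶠ φ g u) ⟨
    k * ⟪ φ ⟫ (mapᶠ g u)       ≈⟨ ⟪⟫-·ᶠ φ k (mapᶠ g u) ⟨
    ⟪ φ ⟫ (k ·ᶠ mapᶠ g u)      ∎

  module _ (A : DecSetoid 0ℓ 0ℓ) where
    open DecSetoid A using () renaming
      (Carrier to ∣A∣; _≈_ to _≈ᴬ_; _≟_ to _≟ᴬ_; refl to ≈ᴬ-refl; sym to ≈ᴬ-sym; trans to ≈ᴬ-trans)

    δ : ∣A∣ → ∣A∣ → 𝕂
    δ a b = if ⌊ b ≟ᴬ a ⌋ then 1# else 0#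

    δ-resp : ∀ a → δ a Preserves _≈ᴬ_ ⟶ _≈_
    δ-resp a {b} {b′} b≈b′ with b ≟ᴬ a | b′ ≟ᴬ a
    ... | yes _   | yes _    = refl
    ... | no _    | no _     = refl
    ... | yes b≈a | no b′≉a  = ⊥-elim (b′≉a (≈ᴬ-trans (≈ᴬ-sym b≈b′) b≈a))
    ... | no b≉a  | yes b′≈a = ⊥-elim (b≉a (≈ᴬ-trans b≈b′ b′≈a))

    coeff≈⟪δ⟫ : ∀ a u → coeff A a u ≈ ⟪ δ a ⟫ u
    coeff≈⟪δ⟫ a []            = refl
    coeff≈⟪δ⟫ a ((k , b) ∷ u) with b ≟ᴬ a
    ... | yes _ = +-cong (sym (*-identityʳ k)) (coeff≈⟪δ⟫ a u)
    ... | no _  = +-cong (sym (zeroʳ k)) (coeff≈⟪δ⟫ a u)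

    ≋⇒Eq : ∀ {u v} → u ≋ v → Eq A u v
    ≋⇒Eq {u} {v} u≋v a = trans (coeff≈⟪δ⟫ a u) (trans (agree u≋v (δ a)) (sym (coeff≈⟪δ⟫ a v)))

    Eq-via-mapᶠ : ∀ {w w′ : FM ∣A∣} (g g′ : B → ∣A∣) (u : FM B) →
      w ≋ mapᶠ g u → w′ ≋ mapᶠ g′ u → (∀ b → g b ≈ᴬ g′ b) → Eq A w w′
    Eq-via-mapᶠ {w = w} {w′} g g′ u w≋gu w′≋g′u g≈g′ a = begin
      coeff A a w          ≈⟨ ≋⇒Eq w≋gu a ⟩
      coeff A a (mapᶠ g u) ≈⟨ coeff≈⟪δ⟫ a (mapᶠ g u) ⟩
      ⟪ δ a ⟫ (mapᶠ g u)   ≈⟨ ⟪⟫-mapᶠ (δ a) g u ⟩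
      ⟪ δ a ∘ g ⟫ u        ≈⟨ ⟪⟫-cong (λ b → δ-resp a (g≈g′ b)) u ⟩
      ⟪ δ a ∘ g′ ⟫ u       ≈⟨ ⟪⟫-mapᶠ (δ a) g′ u ⟨
      ⟪ δ a ⟫ (mapᶠ g′ u)  ≈⟨ coeff≈⟪δ⟫ a (mapᶠ g′ u) ⟨
      coeff A a (mapᶠ g′ u) ≈⟨ ≋⇒Eq w′≋g′u a ⟨
      coeff A a w′         ∎

    remove : ∣A∣ → FM ∣A∣ → FM ∣A∣
    remove a = filter (λ kb → ¬? (proj₂ kb ≟ᴬ a))

    coeff-remove-≈ : ∀ {a b} u → b ≈ᴬ a → coeff A b (remove a u) ≈ 0#
    coeff-remove-≈ []            b≈a = refl
    coeff-remove-≈ {a} {b} ((k , c) ∷ u) b≈a with c ≟ᴬ a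
    ... | yes _ = coeff-remove-≈ u b≈a
    ... | no c≉a with c ≟ᴬ b
    ...   | yes c≈b = ⊥-elim (c≉a (≈ᴬ-trans c≈b b≈a))
    ...   | no _    = trans (+-identityˡ _) (coeff-remove-≈ u b≈a)

    coeff-remove-≉ : ∀ {a b} u → ¬ b ≈ᴬ a → coeff A b (remove a u) ≈ coeff A b u
    coeff-remove-≉ []            b≉a = refl
    coeff-remove-≉ {a} {b} ((k , c) ∷ u) b≉a with c ≟ᴬ a
    ... | no _ = +-congˡ (coeff-remove-≉ u b≉a)
    ... | yes c≈a with c ≟ᴬ b
    ...   | yes c≈b = ⊥-elim (b≉a (≈ᴬ-trans (≈ᴬ-sym c≈b) c≈a))
    ...   | no _    = trans (coeff-remove-≉ u b≉a) (sym (+-identityˡ _))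

    remove-cong : ∀ a u v → Eq A u v → Eq A (remove a u) (remove a v)
    remove-cong a u v u≈v b with b ≟ᴬ a
    ... | yes b≈a = trans (coeff-remove-≈ u b≈a) (sym (coeff-remove-≈ v b≈a))
    ... | no b≉a  = trans (coeff-remove-≉ u b≉a) (trans (u≈v b) (sym (coeff-remove-≉ v b≉a)))

    length-remove : ∀ a u → length (remove a u) ≤ length u
    length-remove a = List.length-filter (λ kb → ¬? (proj₂ kb ≟ᴬ a))

    length-remove-head : ∀ k a u → length (remove a ((k , a) ∷ u)) ≤ length u
    length-remove-head k a u with a ≟ᴬ a
    ... | yes _  = length-remove a u
    ... | no a≉a = ⊥-elim (a≉a ≈ᴬ-refl)

    module _ {φ : ∣A∣ → 𝕂} (φ-resp : φ Preserves _≈ᴬ_ ⟶ _≈_) where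

      ⟪⟫-remove : ∀ a u → ⟪ φ ⟫ u ≈ coeff A a u * φ a + ⟪ φ ⟫ (remove a u)
      ⟪⟫-remove a [] = sym (trans (+-identityʳ _) (zeroˡ _))
      ⟪⟫-remove a ((k , b) ∷ u) with b ≟ᴬ a
      ... | yes b≈a = begin
        k * φ b + ⟪ φ ⟫ u
          ≈⟨ +-cong (*-congˡ (φ-resp b≈a)) (⟪⟫-remove a u) ⟩
        k * φ a + (coeff A a u * φ a + ⟪ φ ⟫ (remove a u))
          ≈⟨ solve 4 (λ k x y z → k :* x :+ (y :* x :+ z) := (k :+ y) :* x :+ z) refl
               k (φ a) (coeff A a u) (⟪ φ ⟫ (remove a u)) ⟩
        (k + coeff A a u) * φ a + ⟪ φ ⟫ (remove a u) ∎
      ... | no _ = begin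
        k * φ b + ⟪ φ ⟫ u
          ≈⟨ +-congˡ (⟪⟫-remove a u) ⟩
        k * φ b + (coeff A a u * φ a + ⟪ φ ⟫ (remove a u))
          ≈⟨ solve 5 (λ k x y z w → k :* w :+ (y :* x :+ z) := (con 0 :+ y) :* x :+ (k :* w :+ z)) refl
               k (φ a) (coeff A a u) (⟪ φ ⟫ (remove a u)) (φ b) ⟩
        (0# + coeff A a u) * φ a + (k * φ b + ⟪ φ ⟫ (remove a u)) ∎

      ⟪⟫-resp-Eq : ∀ u v → Eq A u v → ⟪ φ ⟫ u ≈ ⟪ φ ⟫ v
      ⟪⟫-resp-Eq u v = go (length u ℕ.+ length v) u v ℕ.≤-refl
        where
        peel : ∀ a u v → Eq A u v → ⟪ φ ⟫ (remove a u) ≈ ⟪ φ ⟫ (remove a v) → ⟪ φ ⟫ u ≈ ⟪ φ ⟫ v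
        peel a u v u≈v rest = begin
          ⟪ φ ⟫ u                                    ≈⟨ ⟪⟫-remove a u ⟩
          coeff A a u * φ a + ⟪ φ ⟫ (remove a u)     ≈⟨ +-cong (*-congʳ (u≈v a)) rest ⟩
          coeff A a v * φ a + ⟪ φ ⟫ (remove a v)     ≈⟨ ⟪⟫-remove a v ⟨
          ⟪ φ ⟫ v                                    ∎

        -- n bounds the total length: removing a class of basis elements is not structural recursion.
        go : ∀ n u v → length u ℕ.+ length v ≤ n → Eq A u v → ⟪ φ ⟫ u ≈ ⟪ φ ⟫ v
        go n       []              []              _   _   = refl
        go (suc n) u@((k , a) ∷ u′) v              len u≈v = peel a u v u≈v (go n (remove a u) (remove a v)
          (ℕ.≤-trans (ℕ.+-mono-≤ (length-remove-head k a u′) (length-remove a v)) (ℕ.≤-pred len))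
          (remove-cong a u v u≈v))
        go (suc n) []              v@((k , a) ∷ v′) len u≈v = peel a [] v u≈v (go n [] (remove a v)
          (ℕ.≤-trans (length-remove-head k a v′) (ℕ.≤-pred len))
          (remove-cong a [] v u≈v))

      ⟪⟫-isLinearForm : IsLinearForm A ⟪ φ ⟫
      ⟪⟫-isLinearForm = record
        { cong-≋      = ⟪⟫-resp-Eq
        ; additive    = ⟪⟫-+ᶠ φ
        ; homogeneous = ⟪⟫-·ᶠ φ
        }

  mapᶠ-isLinear : ∀ (A B : DecSetoid 0ℓ 0ℓ) (g : DecSetoid.Carrier A → DecSetoid.Carrier B) →
    g Preserves DecSetoid._≈_ A ⟶ DecSetoid._≈_ B → IsLinear A B (mapᶠ g)
  mapᶠ-isLinear A B g g-resp = record
    { cong-≋      = λ u v u≈v b → begin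
        coeff B b (mapᶠ g u)  ≈⟨ coeff≈⟪δ⟫ B b (mapᶠ g u) ⟩
        ⟪ δ B b ⟫ (mapᶠ g u)  ≈⟨ ⟪⟫-mapᶠ (δ B b) g u ⟩
        ⟪ δ B b ∘ g ⟫ u       ≈⟨ ⟪⟫-resp-Eq A (δ-resp B b ∘ g-resp) u v u≈v ⟩
        ⟪ δ B b ∘ g ⟫ v       ≈⟨ ⟪⟫-mapᶠ (δ B b) g v ⟨
        ⟪ δ B b ⟫ (mapᶠ g v)  ≈⟨ coeff≈⟪δ⟫ B b (mapᶠ g v) ⟨
        coeff B b (mapᶠ g v)  ∎
    ; additive    = λ u v → ≋⇒Eq B (mapᶠ-+ᶠ g u v)
    ; homogeneous = λ k u → ≋⇒Eq B (mapᶠ-·ᶠ g k u)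
    }

  leftInverse⇒injective : ∀ (A B : DecSetoid 0ℓ 0ℓ)
    {F : FM (DecSetoid.Carrier A) → FM (DecSetoid.Carrier B)} {G} →
    IsLinear B A G → (∀ u → Eq A (G (F u)) u) → ∀ u v → Eq B (F u) (F v) → Eq A u v
  leftInverse⇒injective A B {F} {G} G-linear G∘F≈id u v Fu≈Fv a = begin
    coeff A a u           ≈⟨ G∘F≈id u a ⟨
    coeff A a (G (F u))   ≈⟨ IsLinear.cong-≋ G-linear (F u) (F v) Fu≈Fv a ⟩
    coeff A a (G (F v))   ≈⟨ G∘F≈id v a ⟩
    coeff A a v           ∎

-- Opened only now: inside LinearForms these names denote the field operations and its equality.
open ℤ using (ℤ; +_; _+_; _*_; _^_; -_)
open ≡ using (_≡_; refl; sym; trans; cong; cong₂; subst; setoid; module ≡-Reasoning)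
open ≡-Reasoning

private variable
  m n m′ n′ p : ℕ

-- Relabelling and splitting subsets

lookup-preimage : ∀ (s : Fin m → Fin n) A i → lookup (preimage s A) i ≡ lookup A (s i)
lookup-preimage s A = lookup∘tabulate (lookup A ∘ s)

preimage-≡ : ∀ (s : Fin m → Fin n) A V → (∀ i → lookup A (s i) ≡ lookup V i) → preimage s A ≡ V
preimage-≡ s A V h = trans (tabulate-cong h) (tabulate∘lookup V)

lookup-++-join : ∀ (X : Subset m) (Y : Subset n) w → lookup (X ++ Y) (join m n w) ≡ [ lookup X , lookup Y ]′ w
lookup-++-join X Y (inj₁ i) = lookup-++ˡ X Y i
lookup-++-join X Y (inj₂ j) = lookup-++ʳ X Y j

-- σ ⊕ τ, swapF and mid4F are all of the form join ∘ r ∘ splitAt.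
preimage-++ : ∀ (r : Fin m ⊎ Fin n → Fin m′ ⊎ Fin n′) X Y (X′ : Subset m) (Y′ : Subset n) →
  (∀ w → [ lookup X , lookup Y ]′ (r w) ≡ [ lookup X′ , lookup Y′ ]′ w) →
  preimage (join m′ n′ ∘ r ∘ splitAt m) (X ++ Y) ≡ X′ ++ Y′
preimage-++ {m} {n} {m′} {n′} r X Y X′ Y′ h = preimage-≡ _ (X ++ Y) (X′ ++ Y′) λ i → begin
  lookup (X ++ Y) (join m′ n′ (r (splitAt m i)))  ≡⟨ lookup-++-join X Y (r (splitAt m i)) ⟩
  [ lookup X , lookup Y ]′ (r (splitAt m i))      ≡⟨ h (splitAt m i) ⟩
  [ lookup X′ , lookup Y′ ]′ (splitAt m i)        ≡⟨ lookup-splitAt m X′ Y′ i ⟨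
  lookup (X′ ++ Y′) i                             ∎

preimage-⊕ : ∀ (σ : Fin m ↔ Fin m′) (τ : Fin n ↔ Fin n′) X Y →
  preimage (Inverse.to (σ ⊕ τ)) (X ++ Y) ≡ preimage (Inverse.to σ) X ++ preimage (Inverse.to τ) Y
preimage-⊕ σ τ X Y = preimage-++ (Sum.map (Inverse.to σ) (Inverse.to τ)) X Y
    (preimage (Inverse.to σ) X) (preimage (Inverse.to τ) Y) λ where
  (inj₁ i) → sym (lookup-preimage (Inverse.to σ) X i)
  (inj₂ j) → sym (lookup-preimage (Inverse.to τ) Y j)

preimage-swapF : ∀ (X : Subset m) (Y : Subset n) → preimage (Inverse.to (swapF m n)) (Y ++ X) ≡ X ++ Y
preimage-swapF X Y = preimage-++ Sum.swap Y X X Y λ where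
  (inj₁ _) → refl
  (inj₂ _) → refl

preimage-mid4F : ∀ {a₁ a₂ b₁ b₂} (X₁ : Subset a₁) (X₂ : Subset a₂) (Y₁ : Subset b₁) (Y₂ : Subset b₂) →
  preimage (Inverse.to (mid4F a₁ a₂ b₁ b₂)) ((X₁ ++ Y₁) ++ (X₂ ++ Y₂)) ≡ (X₁ ++ X₂) ++ (Y₁ ++ Y₂)
preimage-mid4F {a₁} {a₂} {b₁} {b₂} X₁ X₂ Y₁ Y₂ =
  preimage-++ (Sum.map (join a₁ b₁) (join a₂ b₂) ∘ Inverse.to interchange ∘ Sum.map (splitAt a₁) (splitAt b₁))
    (X₁ ++ Y₁) (X₂ ++ Y₂) (X₁ ++ X₂) (Y₁ ++ Y₂) λ where
      (inj₁ i) → trans (front-half (splitAt a₁ i)) (sym (lookup-splitAt a₁ X₁ X₂ i))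
      (inj₂ j) → trans (back-half (splitAt b₁ j)) (sym (lookup-splitAt b₁ Y₁ Y₂ j))
  where
  front-half : ∀ w → [ lookup (X₁ ++ Y₁) , lookup (X₂ ++ Y₂) ]′
      (Sum.map (join a₁ b₁) (join a₂ b₂) (Inverse.to interchange (inj₁ w))) ≡ [ lookup X₁ , lookup X₂ ]′ w
  front-half (inj₁ i) = lookup-++ˡ X₁ Y₁ i
  front-half (inj₂ i) = lookup-++ˡ X₂ Y₂ i
  back-half : ∀ w → [ lookup (X₁ ++ Y₁) , lookup (X₂ ++ Y₂) ]′
      (Sum.map (join a₁ b₁) (join a₂ b₂) (Inverse.to interchange (inj₂ w))) ≡ [ lookup Y₁ , lookup Y₂ ]′ w
  back-half (inj₁ j) = lookup-++ʳ X₁ Y₁ j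
  back-half (inj₂ j) = lookup-++ʳ X₂ Y₂ j

preimage-cast : ∀ .(e : m ≡ n) (A : Subset n) → preimage (Fin.cast e) A ≡ Vec.cast (sym e) A
preimage-cast e A = preimage-≡ (Fin.cast e) A (Vec.cast (sym e) A) (lookup-cast₂ e A)

preimage-assocF : ∀ (X : Subset m) (Y : Subset n) (Z : Subset p) →
  preimage (Inverse.to (assocF m n p)) ((X ++ Y) ++ Z) ≡ X ++ (Y ++ Z)
preimage-assocF X Y Z = trans (preimage-cast _ ((X ++ Y) ++ Z)) (++-assoc-eqFree X Y Z)

preimage-assocF⁻¹ : ∀ (X : Subset m) (Y : Subset n) (Z : Subset p) →
  preimage (Inverse.to (↔-sym (assocF m n p))) (X ++ (Y ++ Z)) ≡ (X ++ Y) ++ Z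
preimage-assocF⁻¹ X Y Z = trans (preimage-cast _ (X ++ (Y ++ Z))) (cast-sym _ (++-assoc-eqFree X Y Z))

preimage-ridF : ∀ (X : Subset n) → preimage (Inverse.to (ridF n)) (X ++ []) ≡ X
preimage-ridF X = trans (preimage-cast _ (X ++ [])) (++-identityʳ-eqFree X)

front-++ : ∀ (X : Subset m) (Y : Subset n) → front m (X ++ Y) ≡ X
front-++ []      Y = refl
front-++ (x ∷ X) Y = cong (x ∷_) (front-++ X Y)

back-++ : ∀ (X : Subset m) (Y : Subset n) → back m (X ++ Y) ≡ Y
back-++ []      Y = refl
back-++ (x ∷ X) Y = back-++ X Y

++-elim : ∀ {P : Subset (m ℕ.+ n) → Set} → (∀ X Y → P (X ++ Y)) → ∀ A → P A
++-elim {m} h A with Vec.splitAt m A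
... | X , Y , refl = h X Y

∅-++ : ∀ m {n} → ∅ {m ℕ.+ n} ≡ ∅ {m} ++ ∅ {n}
∅-++ zero    = refl
∅-++ (suc m) = cong (false ∷_) (∅-++ m)

∣++∣ : ∀ (X : Subset m) (Y : Subset n) → ∣ X ++ Y ∣ ≡ ∣ X ∣ ℕ.+ ∣ Y ∣
∣++∣ []          Y = refl
∣++∣ (true ∷ X)  Y = cong suc (∣++∣ X Y)
∣++∣ (false ∷ X) Y = ∣++∣ X Y

+∣∅∣ : ∀ k n → k ℕ.+ ∣ ∅ {n} ∣ ≡ k
+∣∅∣ k n = trans (cong (k ℕ.+_) (∣⊥∣≡0 n)) (ℕ.+-identityʳ k)

private
  module ℕΣ = MonoidSum ℕ.+-0-commutativeMonoid
  module ∧Σ = MonoidSum Bool.∧-commutativeMonoid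

Bool→ℕ : Bool → ℕ
Bool→ℕ b = if b then 1 else 0

-- Cardinality and ⊆ᵇ are monoid sums over positions, so sum-permute makes them invariant under
-- relabelling.
∣∣-as-sum : ∀ (X : Subset n) → ∣ X ∣ ≡ ℕΣ.sum (λ i → Bool→ℕ (lookup X i))
∣∣-as-sum []          = refl
∣∣-as-sum (true ∷ X)  = cong suc (∣∣-as-sum X)
∣∣-as-sum (false ∷ X) = ∣∣-as-sum X

⊆ᵇ-as-∧ : ∀ (B A : Subset n) → B ⊆ᵇ A ≡ ∧Σ.sum (λ i → not (lookup B i) ∨ lookup A i)
⊆ᵇ-as-∧ []      []      = refl
⊆ᵇ-as-∧ (b ∷ B) (a ∷ A) = cong ((not b ∨ a) ∧_) (⊆ᵇ-as-∧ B A)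

∣preimage∣ : ∀ (σ : Fin m ↔ Fin n) X → ∣ preimage (Inverse.to σ) X ∣ ≡ ∣ X ∣
∣preimage∣ σ X = begin
  ∣ P X ∣
    ≡⟨ ∣∣-as-sum (P X) ⟩
  ℕΣ.sum (λ i → Bool→ℕ (lookup (P X) i))
    ≡⟨ ℕΣ.sum-cong-≗ (cong Bool→ℕ ∘ lookup-preimage (Inverse.to σ) X) ⟩
  ℕΣ.sum (λ i → Bool→ℕ (lookup X (Inverse.to σ i)))
    ≡⟨ ℕΣ.sum-permute (Bool→ℕ ∘ lookup X) σ ⟨
  ℕΣ.sum (λ j → Bool→ℕ (lookup X j))
    ≡⟨ ∣∣-as-sum X ⟨
  ∣ X ∣ ∎
  where P = preimage (Inverse.to σ)

⊆ᵇ-preimage : ∀ (σ : Fin m ↔ Fin n) B A →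
  preimage (Inverse.to σ) B ⊆ᵇ preimage (Inverse.to σ) A ≡ B ⊆ᵇ A
⊆ᵇ-preimage {m} σ B A = begin
  P B ⊆ᵇ P A
    ≡⟨ ⊆ᵇ-as-∧ (P B) (P A) ⟩
  ∧Σ.sum (λ i → not (lookup (P B) i) ∨ lookup (P A) i)
    ≡⟨ ∧Σ.sum-cong-≗ {m} (λ i → cong₂ (λ b a → not b ∨ a)
         (lookup-preimage (Inverse.to σ) B i) (lookup-preimage (Inverse.to σ) A i)) ⟩
  ∧Σ.sum (λ i → not (lookup B (Inverse.to σ i)) ∨ lookup A (Inverse.to σ i))
    ≡⟨ ∧Σ.sum-permute (λ j → not (lookup B j) ∨ lookup A j) σ ⟨
  ∧Σ.sum (λ j → not (lookup B j) ∨ lookup A j)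
    ≡⟨ ⊆ᵇ-as-∧ B A ⟨
  B ⊆ᵇ A ∎
  where P = preimage (Inverse.to σ)

⊆ᵇ⇒∣∣≤ : ∀ (B A : Subset n) → B ⊆ᵇ A ≡ true → ∣ B ∣ ℕ.≤ ∣ A ∣
⊆ᵇ⇒∣∣≤ []          []          _ = ℕ.z≤n
⊆ᵇ⇒∣∣≤ (false ∷ B) (false ∷ A) p = ⊆ᵇ⇒∣∣≤ B A p
⊆ᵇ⇒∣∣≤ (false ∷ B) (true ∷ A)  p = ℕ.m≤n⇒m≤1+n (⊆ᵇ⇒∣∣≤ B A p)
⊆ᵇ⇒∣∣≤ (true ∷ B)  (true ∷ A)  p = ℕ.s≤s (⊆ᵇ⇒∣∣≤ B A p)

preimage-↔ : Fin m ↔ Fin n → Subset n ↔ Subset m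
preimage-↔ σ = mk↔ₛ′ (preimage (Inverse.to σ)) (preimage (Inverse.from σ))
  (λ X → preimage-≡ (Inverse.to σ) (preimage (Inverse.from σ) X) X λ i →
    trans (lookup-preimage (Inverse.from σ) X (Inverse.to σ i)) (cong (lookup X) (Inverse.strictlyInverseʳ σ i)))
  (λ X → preimage-≡ (Inverse.from σ) (preimage (Inverse.to σ) X) X λ j →
    trans (lookup-preimage (Inverse.to σ) X (Inverse.from σ j)) (cong (lookup X) (Inverse.strictlyInverseˡ σ j)))

-- Sums over all subsets

subsets : ∀ n → List (Subset n)
subsets zero    = [] ∷ []
subsets (suc n) = map (false ∷_) (subsets n) ++ᴸ map (true ∷_) (subsets n)

∈-subsets : ∀ (A : Subset n) → A ∈ subsets n
∈-subsets []                  = here refl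
∈-subsets (false ∷ A)         = ∈-++⁺ˡ (∈-map⁺ (false ∷_) (∈-subsets A))
∈-subsets {suc n} (true ∷ A) = ∈-++⁺ʳ (map (false ∷_) (subsets n)) (∈-map⁺ (true ∷_) (∈-subsets A))

subsets-unique : ∀ n → Unique (subsets n)
subsets-unique zero    = All.[] AllPairs.∷ AllPairs.[]
subsets-unique (suc n) =
  Unique.++⁺ (Unique.map⁺ ∷-injectiveʳ (subsets-unique n)) (Unique.map⁺ ∷-injectiveʳ (subsets-unique n)) disjoint
  where
  disjoint : ∀ {A} → A ∈ map (false ∷_) (subsets n) × A ∈ map (true ∷_) (subsets n) → ⊥
  disjoint (p , q) with ∈-map⁻ (false ∷_) p | ∈-map⁻ (true ∷_) q
  ... | _ , _ , refl | _ , _ , ()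

sumSubsets-cong : ∀ n {h h′ : Subset n → ℤ} → (∀ B → h B ≡ h′ B) → sumSubsets n h ≡ sumSubsets n h′
sumSubsets-cong zero    h≗h′ = h≗h′ []
sumSubsets-cong (suc n) h≗h′ =
  cong₂ _+_ (sumSubsets-cong n (h≗h′ ∘ (false ∷_))) (sumSubsets-cong n (h≗h′ ∘ (true ∷_)))

sumSubsets-0 : ∀ n → sumSubsets n (λ _ → + 0) ≡ + 0
sumSubsets-0 zero    = refl
sumSubsets-0 (suc n) = cong₂ _+_ (sumSubsets-0 n) (sumSubsets-0 n)

sumSubsets-* : ∀ n k (h : Subset n → ℤ) → sumSubsets n (λ B → k * h B) ≡ k * sumSubsets n h
sumSubsets-* zero    k h = refl
sumSubsets-* (suc n) k h = begin
  sumSubsets n (λ B → k * h (false ∷ B)) + sumSubsets n (λ B → k * h (true ∷ B))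
    ≡⟨ cong₂ _+_ (sumSubsets-* n k (h ∘ (false ∷_))) (sumSubsets-* n k (h ∘ (true ∷_))) ⟩
  k * sumSubsets n (h ∘ (false ∷_)) + k * sumSubsets n (h ∘ (true ∷_))
    ≡⟨ ℤP.*-distribˡ-+ k _ _ ⟨
  k * sumSubsets (suc n) h ∎

sumℤ : List ℤ → ℤ
sumℤ = foldr _+_ (+ 0)

sumℤ-++ : ∀ xs ys → sumℤ (xs ++ᴸ ys) ≡ sumℤ xs + sumℤ ys
sumℤ-++ []        ys = sym (ℤP.+-identityˡ (sumℤ ys))
sumℤ-++ (x ∷ xs) ys = trans (cong (_+_ x) (sumℤ-++ xs ys)) (sym (ℤP.+-assoc x (sumℤ xs) (sumℤ ys)))

sumℤ-↭ : ∀ {xs ys} → xs ↭ ys → sumℤ xs ≡ sumℤ ys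
sumℤ-↭ p = ↭ₛ.foldr-commMonoid (setoid ℤ) ℤP.+-0-isCommutativeMonoid (↭⇒↭ₛ p)

sumSubsets-as-sumℤ : ∀ n (h : Subset n → ℤ) → sumSubsets n h ≡ sumℤ (map h (subsets n))
sumSubsets-as-sumℤ zero    h = sym (ℤP.+-identityʳ (h []))
sumSubsets-as-sumℤ (suc n) h = begin
  sumSubsets n (h ∘ (false ∷_)) + sumSubsets n (h ∘ (true ∷_))
    ≡⟨ cong₂ _+_ (sumSubsets-as-sumℤ n (h ∘ (false ∷_))) (sumSubsets-as-sumℤ n (h ∘ (true ∷_))) ⟩
  sumℤ (map (h ∘ (false ∷_)) (subsets n)) + sumℤ (map (h ∘ (true ∷_)) (subsets n))
    ≡⟨ cong₂ (λ xs ys → sumℤ xs + sumℤ ys) (List.map-∘ (subsets n)) (List.map-∘ (subsets n)) ⟩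
  sumℤ (map h (map (false ∷_) (subsets n))) + sumℤ (map h (map (true ∷_) (subsets n)))
    ≡⟨ sumℤ-++ (map h (map (false ∷_) (subsets n))) (map h (map (true ∷_) (subsets n))) ⟨
  sumℤ (map h (map (false ∷_) (subsets n)) ++ᴸ map h (map (true ∷_) (subsets n)))
    ≡⟨ cong sumℤ (List.map-++ h (map (false ∷_) (subsets n)) (map (true ∷_) (subsets n))) ⟨
  sumℤ (map h (subsets (suc n))) ∎

sumSubsets-↔ : ∀ (Π : Subset n ↔ Subset m) (h : Subset m → ℤ) →
  sumSubsets n (h ∘ Inverse.to Π) ≡ sumSubsets m h
sumSubsets-↔ {n} {m} Π h = begin
  sumSubsets n (h ∘ Inverse.to Π)              ≡⟨ sumSubsets-as-sumℤ n (h ∘ Inverse.to Π) ⟩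
  sumℤ (map (h ∘ Inverse.to Π) (subsets n))    ≡⟨ cong sumℤ (List.map-∘ (subsets n)) ⟩
  sumℤ (map h (map (Inverse.to Π) (subsets n))) ≡⟨ sumℤ-↭ (↭.map⁺ h permutation) ⟩
  sumℤ (map h (subsets m))                     ≡⟨ sumSubsets-as-sumℤ m h ⟨
  sumSubsets m h                               ∎
  where
  permutation : map (Inverse.to Π) (subsets n) ↭ subsets m
  permutation = ∼bag⇒↭ (unique∧set⇒bag
    (Unique.map⁺ (Injection.injective (↔⇒↣ Π)) (subsets-unique n)) (subsets-unique m)
    λ {A} → mk⇔ (λ _ → ∈-subsets A) λ _ →
      subst (_∈ map (Inverse.to Π) (subsets n)) (Inverse.strictlyInverseˡ Π A)
        (∈-map⁺ (Inverse.to Π) (∈-subsets (Inverse.from Π A))))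

-- The product and the restrictions of Boolean functions

infix 4 _≈ᴮ_
_≈ᴮ_ : BoolFn n → BoolFn n → Set
f ≈ᴮ g = ∀ A → fn f A ≡ fn g A

starFn-++ : ∀ q₁ q₂ (f : BoolFn m) (g : BoolFn n) X Y →
  starFn q₁ q₂ f g (X ++ Y) ≡ q₁ ^ ∣ Y ∣ * fn f X + q₂ ^ ∣ X ∣ * fn g Y
starFn-++ q₁ q₂ f g X Y rewrite front-++ X Y | back-++ X Y = refl

star-cong : ∀ q₁ q₂ → uncurry (star q₁ q₂ {m} {n}) Preserves Pointwise _≈ᴮ_ _≈ᴮ_ ⟶ _≈ᴮ_
star-cong {m} q₁ q₂ (f≈f′ , g≈g′) A =
  cong₂ (λ a b → q₁ ^ ∣ back m A ∣ * a + q₂ ^ ∣ front m A ∣ * b) (f≈f′ (front m A)) (g≈g′ (back m A))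

star-act : ∀ q₁ q₂ (σ : Fin m ↔ Fin m′) (τ : Fin n ↔ Fin n′) f g →
  star q₁ q₂ (actBool σ f) (actBool τ g) ≈ᴮ actBool (σ ⊕ τ) (star q₁ q₂ f g)
star-act q₁ q₂ σ τ f g = ++-elim λ X Y → begin
  starFn q₁ q₂ (actBool σ f) (actBool τ g) (X ++ Y)   ≡⟨ starFn-++ q₁ q₂ (actBool σ f) (actBool τ g) X Y ⟩
  q₁ ^ ∣ Y ∣ * fn f (Pσ X) + q₂ ^ ∣ X ∣ * fn g (Pτ Y)
    ≡⟨ cong₂ (λ a b → q₁ ^ a * fn f (Pσ X) + q₂ ^ b * fn g (Pτ Y)) (∣preimage∣ τ Y) (∣preimage∣ σ X) ⟨
  q₁ ^ ∣ Pτ Y ∣ * fn f (Pσ X) + q₂ ^ ∣ Pσ X ∣ * fn g (Pτ Y) ≡⟨ starFn-++ q₁ q₂ f g (Pσ X) (Pτ Y) ⟨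
  starFn q₁ q₂ f g (Pσ X ++ Pτ Y)                      ≡⟨ cong (starFn q₁ q₂ f g) (preimage-⊕ σ τ X Y) ⟨
  starFn q₁ q₂ f g (preimage (Inverse.to (σ ⊕ τ)) (X ++ Y)) ∎
  where
  Pσ = preimage (Inverse.to σ)
  Pτ = preimage (Inverse.to τ)

star-assoc : ∀ q₁ q₂ (f : BoolFn m) (g : BoolFn n) (h : BoolFn p) →
  star q₁ q₂ (star q₁ q₂ f g) h ≈ᴮ actBool (assocF m n p) (star q₁ q₂ f (star q₁ q₂ g h))
star-assoc {m} {n} {p} q₁ q₂ f g h = ++-elim λ XY Z → ++-elim (λ X Y → on-blocks X Y Z) XY
  where
  on-blocks : ∀ X Y Z → starFn q₁ q₂ (star q₁ q₂ f g) h ((X ++ Y) ++ Z)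
    ≡ starFn q₁ q₂ f (star q₁ q₂ g h) (preimage (Inverse.to (assocF m n p)) ((X ++ Y) ++ Z))
  on-blocks X Y Z = begin
    starFn q₁ q₂ (star q₁ q₂ f g) h ((X ++ Y) ++ Z)
      ≡⟨ starFn-++ q₁ q₂ (star q₁ q₂ f g) h (X ++ Y) Z ⟩
    q₁ ^ ∣ Z ∣ * starFn q₁ q₂ f g (X ++ Y) + q₂ ^ ∣ X ++ Y ∣ * fn h Z
      ≡⟨ cong₂ (λ a b → q₁ ^ ∣ Z ∣ * a + q₂ ^ b * fn h Z) (starFn-++ q₁ q₂ f g X Y) (∣++∣ X Y) ⟩
    q₁ ^ ∣ Z ∣ * (q₁ ^ ∣ Y ∣ * fn f X + q₂ ^ ∣ X ∣ * fn g Y) + q₂ ^ (∣ X ∣ ℕ.+ ∣ Y ∣) * fn h Z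
      ≡⟨ cong (λ a → q₁ ^ ∣ Z ∣ * (q₁ ^ ∣ Y ∣ * fn f X + q₂ ^ ∣ X ∣ * fn g Y) + a * fn h Z)
           (ℤP.^-distribˡ-+-* q₂ ∣ X ∣ ∣ Y ∣) ⟩
    q₁ ^ ∣ Z ∣ * (q₁ ^ ∣ Y ∣ * fn f X + q₂ ^ ∣ X ∣ * fn g Y) + q₂ ^ ∣ X ∣ * q₂ ^ ∣ Y ∣ * fn h Z
      ≡⟨ regroup (q₁ ^ ∣ Z ∣) (q₁ ^ ∣ Y ∣) (q₂ ^ ∣ X ∣) (q₂ ^ ∣ Y ∣) (fn f X) (fn g Y) (fn h Z) ⟩
    q₁ ^ ∣ Y ∣ * q₁ ^ ∣ Z ∣ * fn f X + q₂ ^ ∣ X ∣ * (q₁ ^ ∣ Z ∣ * fn g Y + q₂ ^ ∣ Y ∣ * fn h Z)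
      ≡⟨ cong₂ (λ a b → a * fn f X + q₂ ^ ∣ X ∣ * b)
           (trans (cong (q₁ ^_) (∣++∣ Y Z)) (ℤP.^-distribˡ-+-* q₁ ∣ Y ∣ ∣ Z ∣))
           (starFn-++ q₁ q₂ g h Y Z) ⟨
    q₁ ^ ∣ Y ++ Z ∣ * fn f X + q₂ ^ ∣ X ∣ * starFn q₁ q₂ g h (Y ++ Z)
      ≡⟨ starFn-++ q₁ q₂ f (star q₁ q₂ g h) X (Y ++ Z) ⟨
    starFn q₁ q₂ f (star q₁ q₂ g h) (X ++ (Y ++ Z))
      ≡⟨ cong (starFn q₁ q₂ f (star q₁ q₂ g h)) (preimage-assocF X Y Z) ⟨
    starFn q₁ q₂ f (star q₁ q₂ g h) (preimage (Inverse.to (assocF m n p)) ((X ++ Y) ++ Z)) ∎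
    where
    regroup : ∀ z y x y′ F G H →
      z * (y * F + x * G) + x * y′ * H ≡ y * z * F + x * (z * G + y′ * H)
    regroup = solve-∀

star-oneˡ : ∀ q₁ q₂ (f : BoolFn n) → star q₁ q₂ oneBool f ≈ᴮ f
star-oneˡ q₁ q₂ f A = begin
  q₁ ^ ∣ A ∣ * + 0 + ℤ.1ℤ * fn f A ≡⟨ cong₂ _+_ (ℤP.*-zeroʳ (q₁ ^ ∣ A ∣)) (ℤP.*-identityˡ (fn f A)) ⟩
  + 0 + fn f A                      ≡⟨ ℤP.+-identityˡ (fn f A) ⟩
  fn f A                            ∎

star-oneʳ : ∀ q₁ q₂ (f : BoolFn n) → star q₁ q₂ f oneBool ≈ᴮ actBool (ridF n) f
star-oneʳ {n} q₁ q₂ f = ++-elim {n} {0} λ where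
  X [] → begin
    starFn q₁ q₂ f oneBool (X ++ [])
      ≡⟨ starFn-++ q₁ q₂ f oneBool X [] ⟩
    ℤ.1ℤ * fn f X + q₂ ^ ∣ X ∣ * + 0
      ≡⟨ cong₂ _+_ (ℤP.*-identityˡ (fn f X)) (ℤP.*-zeroʳ (q₂ ^ ∣ X ∣)) ⟩
    fn f X + + 0
      ≡⟨ ℤP.+-identityʳ (fn f X) ⟩
    fn f X
      ≡⟨ cong (fn f) (preimage-ridF X) ⟨
    fn f (preimage (Inverse.to (ridF n)) (X ++ [])) ∎

restrictˡ-act : ∀ (σ : Fin m ↔ Fin m′) (τ : Fin n ↔ Fin n′) f →
  restrictˡ m′ (actBool (σ ⊕ τ) f) ≈ᴮ actBool σ (restrictˡ m f)
restrictˡ-act σ τ f A = cong (fn f) (begin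
  preimage (Inverse.to (σ ⊕ τ)) (A ++ ∅)
    ≡⟨ preimage-⊕ σ τ A ∅ ⟩
  preimage (Inverse.to σ) A ++ preimage (Inverse.to τ) ∅
    ≡⟨ cong (preimage (Inverse.to σ) A ++_) (preimage-∅ (Inverse.to τ)) ⟩
  preimage (Inverse.to σ) A ++ ∅ ∎)

restrictʳ-act : ∀ (σ : Fin m ↔ Fin m′) (τ : Fin n ↔ Fin n′) f →
  restrictʳ m′ (actBool (σ ⊕ τ) f) ≈ᴮ actBool τ (restrictʳ m f)
restrictʳ-act σ τ f A = cong (fn f) (begin
  preimage (Inverse.to (σ ⊕ τ)) (∅ ++ A)
    ≡⟨ preimage-⊕ σ τ ∅ A ⟩
  preimage (Inverse.to σ) ∅ ++ preimage (Inverse.to τ) A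
    ≡⟨ cong (_++ preimage (Inverse.to τ) A) (preimage-∅ (Inverse.to σ)) ⟩
  ∅ ++ preimage (Inverse.to τ) A ∎)

act-assocF⁻¹-++ : ∀ (f : BoolFn ((m ℕ.+ n) ℕ.+ p)) (X : Subset m) (Y : Subset n) (Z : Subset p) →
  fn (actBool (↔-sym (assocF m n p)) f) (X ++ (Y ++ Z)) ≡ fn f ((X ++ Y) ++ Z)
act-assocF⁻¹-++ f X Y Z = cong (fn f) (preimage-assocF⁻¹ X Y Z)

restrictˡ-restrictˡ : ∀ (f : BoolFn ((m ℕ.+ n) ℕ.+ p)) →
  restrictˡ m (restrictˡ (m ℕ.+ n) f) ≈ᴮ restrictˡ m (actBool (↔-sym (assocF m n p)) f)
restrictˡ-restrictˡ {m} {n} {p} f X = sym (begin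
  fn f′ (X ++ ∅)                ≡⟨ cong (fn f′ ∘ (X ++_)) (∅-++ n) ⟩
  fn f′ (X ++ (∅ {n} ++ ∅ {p})) ≡⟨ act-assocF⁻¹-++ f X (∅ {n}) (∅ {p}) ⟩
  fn f ((X ++ ∅) ++ ∅)          ∎)
  where f′ = actBool (↔-sym (assocF m n p)) f

restrictʳ-restrictˡ : ∀ (f : BoolFn ((m ℕ.+ n) ℕ.+ p)) →
  restrictʳ m (restrictˡ (m ℕ.+ n) f) ≈ᴮ restrictˡ n (restrictʳ m (actBool (↔-sym (assocF m n p)) f))
restrictʳ-restrictˡ {m} {n} {p} f Y = sym (act-assocF⁻¹-++ f (∅ {m}) Y (∅ {p}))

restrictʳ-restrictʳ : ∀ (f : BoolFn ((m ℕ.+ n) ℕ.+ p)) →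
  restrictʳ (m ℕ.+ n) f ≈ᴮ restrictʳ n (restrictʳ m (actBool (↔-sym (assocF m n p)) f))
restrictʳ-restrictʳ {m} {n} {p} f Z = begin
  fn f (∅ ++ Z)                 ≡⟨ cong (fn f ∘ (_++ Z)) (∅-++ m) ⟩
  fn f ((∅ {m} ++ ∅ {n}) ++ Z)  ≡⟨ act-assocF⁻¹-++ f (∅ {m}) (∅ {n}) Z ⟨
  fn (actBool (↔-sym (assocF m n p)) f) (∅ {m} ++ (∅ {n} ++ Z)) ∎

restrictˡ-ridF : ∀ (f : BoolFn n) → restrictˡ n (actBool (ridF n) f) ≈ᴮ f
restrictˡ-ridF f A = cong (fn f) (preimage-ridF A)

restrictˡ-swapF : ∀ (f : BoolFn (m ℕ.+ n)) → restrictˡ n (actBool (swapF m n) f) ≈ᴮ restrictʳ m f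
restrictˡ-swapF {m} f A = cong (fn f) (preimage-swapF (∅ {m}) A)

restrictʳ-swapF : ∀ (f : BoolFn (m ℕ.+ n)) → restrictʳ n (actBool (swapF m n) f) ≈ᴮ restrictˡ m f
restrictʳ-swapF {n = n} f A = cong (fn f) (preimage-swapF A (∅ {n}))

module _ (q₁ q₂ : ℤ) (a₁ a₂ b₁ b₂ : ℕ) (f : BoolFn (a₁ ℕ.+ a₂)) (g : BoolFn (b₁ ℕ.+ b₂)) where

  star-mid4F : ∀ (X₁ : Subset a₁) (X₂ : Subset a₂) (Y₁ : Subset b₁) (Y₂ : Subset b₂) →
    fn (actBool (mid4F a₁ a₂ b₁ b₂) (star q₁ q₂ f g)) ((X₁ ++ Y₁) ++ (X₂ ++ Y₂))
      ≡ q₁ ^ (∣ Y₁ ∣ ℕ.+ ∣ Y₂ ∣) * fn f (X₁ ++ X₂) + q₂ ^ (∣ X₁ ∣ ℕ.+ ∣ X₂ ∣) * fn g (Y₁ ++ Y₂)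
  star-mid4F X₁ X₂ Y₁ Y₂ = begin
    starFn q₁ q₂ f g (preimage (Inverse.to (mid4F a₁ a₂ b₁ b₂)) ((X₁ ++ Y₁) ++ (X₂ ++ Y₂)))
      ≡⟨ cong (starFn q₁ q₂ f g) (preimage-mid4F X₁ X₂ Y₁ Y₂) ⟩
    starFn q₁ q₂ f g ((X₁ ++ X₂) ++ (Y₁ ++ Y₂))
      ≡⟨ starFn-++ q₁ q₂ f g (X₁ ++ X₂) (Y₁ ++ Y₂) ⟩
    q₁ ^ ∣ Y₁ ++ Y₂ ∣ * fn f (X₁ ++ X₂) + q₂ ^ ∣ X₁ ++ X₂ ∣ * fn g (Y₁ ++ Y₂)
      ≡⟨ cong₂ (λ a b → q₁ ^ a * fn f (X₁ ++ X₂) + q₂ ^ b * fn g (Y₁ ++ Y₂)) (∣++∣ Y₁ Y₂) (∣++∣ X₁ X₂) ⟩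
    q₁ ^ (∣ Y₁ ∣ ℕ.+ ∣ Y₂ ∣) * fn f (X₁ ++ X₂) + q₂ ^ (∣ X₁ ∣ ℕ.+ ∣ X₂ ∣) * fn g (Y₁ ++ Y₂) ∎

  restrictˡ-star : restrictˡ (a₁ ℕ.+ b₁) (actBool (mid4F a₁ a₂ b₁ b₂) (star q₁ q₂ f g))
    ≈ᴮ star q₁ q₂ (restrictˡ a₁ f) (restrictˡ b₁ g)
  restrictˡ-star = ++-elim λ X₁ Y₁ → begin
    fn fg ((X₁ ++ Y₁) ++ ∅)
      ≡⟨ cong (fn fg ∘ ((X₁ ++ Y₁) ++_)) (∅-++ a₂) ⟩
    fn fg ((X₁ ++ Y₁) ++ (∅ {a₂} ++ ∅ {b₂}))
      ≡⟨ star-mid4F X₁ ∅ Y₁ ∅ ⟩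
    q₁ ^ (∣ Y₁ ∣ ℕ.+ ∣ ∅ {b₂} ∣) * fn f (X₁ ++ ∅) + q₂ ^ (∣ X₁ ∣ ℕ.+ ∣ ∅ {a₂} ∣) * fn g (Y₁ ++ ∅)
      ≡⟨ cong₂ (λ a b → q₁ ^ a * fn f (X₁ ++ ∅) + q₂ ^ b * fn g (Y₁ ++ ∅)) (+∣∅∣ ∣ Y₁ ∣ b₂) (+∣∅∣ ∣ X₁ ∣ a₂) ⟩
    q₁ ^ ∣ Y₁ ∣ * fn f (X₁ ++ ∅) + q₂ ^ ∣ X₁ ∣ * fn g (Y₁ ++ ∅)
      ≡⟨ starFn-++ q₁ q₂ (restrictˡ a₁ f) (restrictˡ b₁ g) X₁ Y₁ ⟨
    starFn q₁ q₂ (restrictˡ a₁ f) (restrictˡ b₁ g) (X₁ ++ Y₁) ∎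
    where fg = actBool (mid4F a₁ a₂ b₁ b₂) (star q₁ q₂ f g)

  restrictʳ-star : restrictʳ (a₁ ℕ.+ b₁) (actBool (mid4F a₁ a₂ b₁ b₂) (star q₁ q₂ f g))
    ≈ᴮ star q₁ q₂ (restrictʳ a₁ f) (restrictʳ b₁ g)
  restrictʳ-star = ++-elim λ X₂ Y₂ → begin
    fn fg (∅ {a₁ ℕ.+ b₁} ++ (X₂ ++ Y₂))
      ≡⟨ cong (fn fg ∘ (_++ (X₂ ++ Y₂))) (∅-++ a₁) ⟩
    fn fg ((∅ {a₁} ++ ∅ {b₁}) ++ (X₂ ++ Y₂))
      ≡⟨ star-mid4F ∅ X₂ ∅ Y₂ ⟩
    q₁ ^ (∣ ∅ {b₁} ∣ ℕ.+ ∣ Y₂ ∣) * fn f (∅ ++ X₂) + q₂ ^ (∣ ∅ {a₁} ∣ ℕ.+ ∣ X₂ ∣) * fn g (∅ ++ Y₂)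
      ≡⟨ cong₂ (λ a b → q₁ ^ (a ℕ.+ ∣ Y₂ ∣) * fn f (∅ ++ X₂) + q₂ ^ (b ℕ.+ ∣ X₂ ∣) * fn g (∅ ++ Y₂))
           (∣⊥∣≡0 b₁) (∣⊥∣≡0 a₁) ⟩
    q₁ ^ ∣ Y₂ ∣ * fn f (∅ ++ X₂) + q₂ ^ ∣ X₂ ∣ * fn g (∅ ++ Y₂)
      ≡⟨ starFn-++ q₁ q₂ (restrictʳ a₁ f) (restrictʳ b₁ g) X₂ Y₂ ⟨
    starFn q₁ q₂ (restrictʳ a₁ f) (restrictʳ b₁ g) (X₂ ++ Y₂) ∎
    where fg = actBool (mid4F a₁ a₂ b₁ b₂) (star q₁ q₂ f g)

-- The transformation θ_q

-- θ_q in recursive form: the subsets of a ∷ A split according to whether they contain the new point.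
zeta : ℤ → (Subset n → ℤ) → Subset n → ℤ
zeta q h []          = h []
zeta q h (false ∷ A) = zeta q (h ∘ (false ∷_)) A
zeta q h (true ∷ A)  = q * zeta q (h ∘ (false ∷_)) A + zeta q (h ∘ (true ∷_)) A

zeta-cong : ∀ q {h h′ : Subset n → ℤ} → (∀ B → h B ≡ h′ B) → ∀ A → zeta q h A ≡ zeta q h′ A
zeta-cong q h≗h′ []          = h≗h′ []
zeta-cong q h≗h′ (false ∷ A) = zeta-cong q (h≗h′ ∘ (false ∷_)) A
zeta-cong q h≗h′ (true ∷ A)  =
  cong₂ (λ x y → q * x + y) (zeta-cong q (h≗h′ ∘ (false ∷_)) A) (zeta-cong q (h≗h′ ∘ (true ∷_)) A)

zeta-+ : ∀ q (h₁ h₂ : Subset n → ℤ) A → zeta q (λ B → h₁ B + h₂ B) A ≡ zeta q h₁ A + zeta q h₂ A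
zeta-+ q h₁ h₂ []          = refl
zeta-+ q h₁ h₂ (false ∷ A) = zeta-+ q (h₁ ∘ (false ∷_)) (h₂ ∘ (false ∷_)) A
zeta-+ q h₁ h₂ (true ∷ A)  = begin
  q * zeta q (λ B → h₁ (false ∷ B) + h₂ (false ∷ B)) A + zeta q (λ B → h₁ (true ∷ B) + h₂ (true ∷ B)) A
    ≡⟨ cong₂ (λ x y → q * x + y) (zeta-+ q (h₁ ∘ (false ∷_)) (h₂ ∘ (false ∷_)) A)
                                 (zeta-+ q (h₁ ∘ (true ∷_)) (h₂ ∘ (true ∷_)) A) ⟩
  q * (a₁ + a₂) + (b₁ + b₂)   ≡⟨ regroup q a₁ a₂ b₁ b₂ ⟩
  (q * a₁ + b₁) + (q * a₂ + b₂) ∎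
  where
  a₁ = zeta q (h₁ ∘ (false ∷_)) A
  a₂ = zeta q (h₂ ∘ (false ∷_)) A
  b₁ = zeta q (h₁ ∘ (true ∷_)) A
  b₂ = zeta q (h₂ ∘ (true ∷_)) A
  regroup : ∀ q a₁ a₂ b₁ b₂ → q * (a₁ + a₂) + (b₁ + b₂) ≡ (q * a₁ + b₁) + (q * a₂ + b₂)
  regroup = solve-∀

zeta-* : ∀ q k (h : Subset n → ℤ) A → zeta q (λ B → k * h B) A ≡ k * zeta q h A
zeta-* q k h []          = refl
zeta-* q k h (false ∷ A) = zeta-* q k (h ∘ (false ∷_)) A
zeta-* q k h (true ∷ A)  = begin
  q * zeta q (λ B → k * h (false ∷ B)) A + zeta q (λ B → k * h (true ∷ B)) A
    ≡⟨ cong₂ (λ x y → q * x + y) (zeta-* q k (h ∘ (false ∷_)) A) (zeta-* q k (h ∘ (true ∷_)) A) ⟩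
  q * (k * a) + k * b   ≡⟨ regroup q k a b ⟩
  k * (q * a + b)       ∎
  where
  a = zeta q (h ∘ (false ∷_)) A
  b = zeta q (h ∘ (true ∷_)) A
  regroup : ∀ q k a b → q * (k * a) + k * b ≡ k * (q * a + b)
  regroup = solve-∀

zeta-++ : ∀ q (u : Subset m → ℤ) (v : Subset n → ℤ) A₁ A₂ →
  zeta q (λ B → u (front m B) * v (back m B)) (A₁ ++ A₂) ≡ zeta q u A₁ * zeta q v A₂
zeta-++ q u v []           A₂ = zeta-* q (u []) v A₂
zeta-++ q u v (false ∷ A₁) A₂ = zeta-++ q (u ∘ (false ∷_)) v A₁ A₂
zeta-++ q u v (true ∷ A₁)  A₂ = begin
  q * zeta q (λ B → u (false ∷ front _ B) * v (back _ B)) (A₁ ++ A₂)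
    + zeta q (λ B → u (true ∷ front _ B) * v (back _ B)) (A₁ ++ A₂)
    ≡⟨ cong₂ (λ x y → q * x + y) (zeta-++ q (u ∘ (false ∷_)) v A₁ A₂) (zeta-++ q (u ∘ (true ∷_)) v A₁ A₂) ⟩
  q * (a * c) + b * c   ≡⟨ regroup q a b c ⟩
  (q * a + b) * c       ∎
  where
  a = zeta q (u ∘ (false ∷_)) A₁
  b = zeta q (u ∘ (true ∷_)) A₁
  c = zeta q v A₂
  regroup : ∀ q a b c → q * (a * c) + b * c ≡ (q * a + b) * c
  regroup = solve-∀

zeta-^∣∣ : ∀ q c (A : Subset n) → zeta q (λ B → c ^ ∣ B ∣) A ≡ (c + q) ^ ∣ A ∣
zeta-^∣∣ q c []          = refl
zeta-^∣∣ q c (false ∷ A) = zeta-^∣∣ q c A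
zeta-^∣∣ q c (true ∷ A)  = begin
  q * zeta q (λ B → c ^ ∣ B ∣) A + zeta q (λ B → c * c ^ ∣ B ∣) A
    ≡⟨ cong (_+_ (q * zeta q (λ B → c ^ ∣ B ∣) A)) (zeta-* q c (λ B → c ^ ∣ B ∣) A) ⟩
  q * zeta q (λ B → c ^ ∣ B ∣) A + c * zeta q (λ B → c ^ ∣ B ∣) A
    ≡⟨ cong (λ x → q * x + c * x) (zeta-^∣∣ q c A) ⟩
  q * (c + q) ^ ∣ A ∣ + c * (c + q) ^ ∣ A ∣  ≡⟨ regroup q c ((c + q) ^ ∣ A ∣) ⟩
  (c + q) * (c + q) ^ ∣ A ∣                  ∎
  where
  regroup : ∀ q c x → q * x + c * x ≡ (c + q) * x
  regroup = solve-∀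

zeta-inverse : ∀ q (h : Subset n → ℤ) A → zeta (- q) (zeta q h) A ≡ h A
zeta-inverse q h []          = refl
zeta-inverse q h (false ∷ A) = zeta-inverse q (h ∘ (false ∷_)) A
zeta-inverse q h (true ∷ A)  = begin
  - q * zeta (- q) (zeta q h₀) A + zeta (- q) (λ B → q * zeta q h₀ B + zeta q h₁ B) A
    ≡⟨ cong (_+_ (- q * zeta (- q) (zeta q h₀) A)) (zeta-+ (- q) (λ B → q * zeta q h₀ B) (zeta q h₁) A) ⟩
  - q * zeta (- q) (zeta q h₀) A + (zeta (- q) (λ B → q * zeta q h₀ B) A + zeta (- q) (zeta q h₁) A)
    ≡⟨ cong (λ x → - q * zeta (- q) (zeta q h₀) A + (x + zeta (- q) (zeta q h₁) A))
         (zeta-* (- q) q (zeta q h₀) A) ⟩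
  - q * zeta (- q) (zeta q h₀) A + (q * zeta (- q) (zeta q h₀) A + zeta (- q) (zeta q h₁) A)
    ≡⟨ cancel q (zeta (- q) (zeta q h₀) A) (zeta (- q) (zeta q h₁) A) ⟩
  zeta (- q) (zeta q h₁) A
    ≡⟨ zeta-inverse q h₁ A ⟩
  h (true ∷ A) ∎
  where
  h₀ = h ∘ (false ∷_)
  h₁ = h ∘ (true ∷_)
  cancel : ∀ q x y → - q * x + (q * x + y) ≡ y
  cancel = solve-∀

zeta-∅ : ∀ q (h : Subset n → ℤ) → zeta q h ∅ ≡ h ∅
zeta-∅ {zero}  q h = refl
zeta-∅ {suc n} q h = zeta-∅ q (h ∘ (false ∷_))

zeta-++∅ : ∀ q (h : Subset (m ℕ.+ n) → ℤ) (A : Subset m) → zeta q h (A ++ ∅) ≡ zeta q (λ B → h (B ++ ∅)) A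
zeta-++∅ q h []          = zeta-∅ q h
zeta-++∅ q h (false ∷ A) = zeta-++∅ q (h ∘ (false ∷_)) A
zeta-++∅ q h (true ∷ A)  =
  cong₂ (λ x y → q * x + y) (zeta-++∅ q (h ∘ (false ∷_)) A) (zeta-++∅ q (h ∘ (true ∷_)) A)

zeta-∅++ : ∀ q m (h : Subset (m ℕ.+ n) → ℤ) (A : Subset n) →
  zeta q h (∅ {m} ++ A) ≡ zeta q (λ B → h (∅ {m} ++ B)) A
zeta-∅++ q zero    h A = refl
zeta-∅++ q (suc m) h A = zeta-∅++ q m (h ∘ (false ∷_)) A

thetaSum : ℤ → ∀ n → (Subset n → ℤ) → Subset n → ℤ
thetaSum q n h A = sumSubsets n (λ B → if B ⊆ᵇ A then q ^ (∣ A ∣ ∸ ∣ B ∣) * h B else + 0)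

thetaSum≡zeta : ∀ q n (h : Subset n → ℤ) A → thetaSum q n h A ≡ zeta q h A
thetaSum≡zeta q zero    h []          = ℤP.*-identityˡ (h [])
thetaSum≡zeta q (suc n) h (false ∷ A) = begin
  thetaSum q n (h ∘ (false ∷_)) A + sumSubsets n (λ _ → + 0)
    ≡⟨ cong (_+_ (thetaSum q n (h ∘ (false ∷_)) A)) (sumSubsets-0 n) ⟩
  thetaSum q n (h ∘ (false ∷_)) A + + 0   ≡⟨ ℤP.+-identityʳ _ ⟩
  thetaSum q n (h ∘ (false ∷_)) A         ≡⟨ thetaSum≡zeta q n (h ∘ (false ∷_)) A ⟩
  zeta q (h ∘ (false ∷_)) A                  ∎
thetaSum≡zeta q (suc n) h (true ∷ A) = cong₂ _+_
  (begin
    sumSubsets n (λ B → if B ⊆ᵇ A then q ^ (suc ∣ A ∣ ∸ ∣ B ∣) * h (false ∷ B) else + 0)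
      ≡⟨ sumSubsets-cong n one-more-point ⟩
    sumSubsets n (λ B → q * (if B ⊆ᵇ A then q ^ (∣ A ∣ ∸ ∣ B ∣) * h (false ∷ B) else + 0))
      ≡⟨ sumSubsets-* n q _ ⟩
    q * thetaSum q n (h ∘ (false ∷_)) A
      ≡⟨ cong (q *_) (thetaSum≡zeta q n (h ∘ (false ∷_)) A) ⟩
    q * zeta q (h ∘ (false ∷_)) A ∎)
  (thetaSum≡zeta q n (h ∘ (true ∷_)) A)
  where
  -- The exponent uses truncated subtraction; it only matters when B ⊆ᵇ A, where ∣ B ∣ ≤ ∣ A ∣.
  one-more-point : ∀ B → (if B ⊆ᵇ A then q ^ (suc ∣ A ∣ ∸ ∣ B ∣) * h (false ∷ B) else + 0)
                       ≡ q * (if B ⊆ᵇ A then q ^ (∣ A ∣ ∸ ∣ B ∣) * h (false ∷ B) else + 0)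
  one-more-point B with B ⊆ᵇ A in B⊆A
  ... | true  rewrite ℕ.+-∸-assoc 1 (⊆ᵇ⇒∣∣≤ B A B⊆A) = ℤP.*-assoc q _ _
  ... | false = sym (ℤP.*-zeroʳ q)

theta≡zeta : ∀ q (f : BoolFn n) A → fn (theta q f) A ≡ zeta q (fn f) A
theta≡zeta {n} q f = thetaSum≡zeta q n (fn f)

theta-cong : ∀ q → theta q {n} Preserves _≈ᴮ_ ⟶ _≈ᴮ_
theta-cong q {f} {g} f≈g A = begin
  fn (theta q f) A   ≡⟨ theta≡zeta q f A ⟩
  zeta q (fn f) A    ≡⟨ zeta-cong q f≈g A ⟩
  zeta q (fn g) A    ≡⟨ theta≡zeta q g A ⟨
  fn (theta q g) A   ∎

theta-inverse : ∀ q (f : BoolFn n) → theta (- q) (theta q f) ≈ᴮ f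
theta-inverse q f A = begin
  fn (theta (- q) (theta q f)) A      ≡⟨ theta≡zeta (- q) (theta q f) A ⟩
  zeta (- q) (fn (theta q f)) A       ≡⟨ zeta-cong (- q) (theta≡zeta q f) A ⟩
  zeta (- q) (zeta q (fn f)) A        ≡⟨ zeta-inverse q (fn f) A ⟩
  fn f A                              ∎

theta-inverseʳ : ∀ q (f : BoolFn n) → theta q (theta (- q) f) ≈ᴮ f
theta-inverseʳ q f A = begin
  fn (theta q (theta (- q) f)) A      ≡⟨ cong (λ q′ → fn (theta q′ (theta (- q) f)) A) (ℤP.neg-involutive q) ⟨
  fn (theta (- - q) (theta (- q) f)) A ≡⟨ theta-inverse (- q) f A ⟩
  fn f A                              ∎

theta-on-∅ : ∀ q (f : BoolFn 0) → theta q f ≈ᴮ f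
theta-on-∅ q f [] = theta≡zeta q f []

theta-restrictˡ : ∀ q m (f : BoolFn (m ℕ.+ n)) → restrictˡ m (theta q f) ≈ᴮ theta q (restrictˡ m f)
theta-restrictˡ q m f A = begin
  fn (theta q f) (A ++ ∅)                ≡⟨ theta≡zeta q f (A ++ ∅) ⟩
  zeta q (fn f) (A ++ ∅)                 ≡⟨ zeta-++∅ q (fn f) A ⟩
  zeta q (fn (restrictˡ m f)) A          ≡⟨ theta≡zeta q (restrictˡ m f) A ⟨
  fn (theta q (restrictˡ m f)) A         ∎

theta-restrictʳ : ∀ q m (f : BoolFn (m ℕ.+ n)) → restrictʳ m (theta q f) ≈ᴮ theta q (restrictʳ m f)
theta-restrictʳ q m f A = begin
  fn (theta q f) (∅ ++ A)                ≡⟨ theta≡zeta q f (∅ ++ A) ⟩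
  zeta q (fn f) (∅ ++ A)                 ≡⟨ zeta-∅++ q m (fn f) A ⟩
  zeta q (fn (restrictʳ m f)) A          ≡⟨ theta≡zeta q (restrictʳ m f) A ⟨
  fn (theta q (restrictʳ m f)) A         ∎

theta-star : ∀ q q₁ q₂ (f : BoolFn m) (g : BoolFn n) →
  theta q (star q₁ q₂ f g) ≈ᴮ star (q₁ + q) (q₂ + q) (theta q f) (theta q g)
theta-star {m} q q₁ q₂ f g = ++-elim λ X Y → begin
  fn (theta q (star q₁ q₂ f g)) (X ++ Y)
    ≡⟨ theta≡zeta q (star q₁ q₂ f g) (X ++ Y) ⟩
  zeta q (starFn q₁ q₂ f g) (X ++ Y)
    ≡⟨ zeta-cong q (λ B → cong (_+ right B) (ℤP.*-comm (q₁ ^ ∣ back m B ∣) (fn f (front m B)))) (X ++ Y) ⟩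
  zeta q (λ B → left B + right B) (X ++ Y)
    ≡⟨ zeta-+ q left right (X ++ Y) ⟩
  zeta q left (X ++ Y) + zeta q right (X ++ Y)
    ≡⟨ cong₂ _+_ (zeta-++ q (fn f) (λ C → q₁ ^ ∣ C ∣) X Y) (zeta-++ q (λ C → q₂ ^ ∣ C ∣) (fn g) X Y) ⟩
  zeta q (fn f) X * zeta q (λ C → q₁ ^ ∣ C ∣) Y + zeta q (λ C → q₂ ^ ∣ C ∣) X * zeta q (fn g) Y
    ≡⟨ cong₂ (λ a b → zeta q (fn f) X * a + b * zeta q (fn g) Y) (zeta-^∣∣ q q₁ Y) (zeta-^∣∣ q q₂ X) ⟩
  zeta q (fn f) X * (q₁ + q) ^ ∣ Y ∣ + (q₂ + q) ^ ∣ X ∣ * zeta q (fn g) Y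
    ≡⟨ cong (_+ (q₂ + q) ^ ∣ X ∣ * zeta q (fn g) Y) (ℤP.*-comm (zeta q (fn f) X) ((q₁ + q) ^ ∣ Y ∣)) ⟩
  (q₁ + q) ^ ∣ Y ∣ * zeta q (fn f) X + (q₂ + q) ^ ∣ X ∣ * zeta q (fn g) Y
    ≡⟨ cong₂ (λ a b → (q₁ + q) ^ ∣ Y ∣ * a + (q₂ + q) ^ ∣ X ∣ * b) (theta≡zeta q f X) (theta≡zeta q g Y) ⟨
  (q₁ + q) ^ ∣ Y ∣ * fn (theta q f) X + (q₂ + q) ^ ∣ X ∣ * fn (theta q g) Y
    ≡⟨ starFn-++ (q₁ + q) (q₂ + q) (theta q f) (theta q g) X Y ⟨
  starFn (q₁ + q) (q₂ + q) (theta q f) (theta q g) (X ++ Y) ∎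
  where
  left right : Subset (m ℕ.+ _) → ℤ
  left  B = fn f (front m B) * q₁ ^ ∣ back m B ∣
  right B = q₂ ^ ∣ front m B ∣ * fn g (back m B)

theta-act : ∀ q (σ : Fin m ↔ Fin n) (f : BoolFn m) → theta q (actBool σ f) ≈ᴮ actBool σ (theta q f)
theta-act {m} {n} q σ f A = begin
  thetaSum q n (fn f ∘ P) A
    ≡⟨ sumSubsets-cong n (λ B → cong₂ (λ b k → if b then q ^ k * fn f (P B) else + 0)
         (sym (⊆ᵇ-preimage σ B A)) (sym (cong₂ _∸_ (∣preimage∣ σ A) (∣preimage∣ σ B)))) ⟩
  sumSubsets n (term ∘ P)
    ≡⟨ sumSubsets-↔ (preimage-↔ σ) term ⟩
  thetaSum q m (fn f) (P A) ∎
  where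
  P = preimage (Inverse.to σ)
  term : Subset m → ℤ
  term C = if C ⊆ᵇ P A then q ^ (∣ P A ∣ ∸ ∣ C ∣) * fn f C else + 0

module BoolBialgebraProofs {c ℓ} (K : Field c ℓ) where
  open Field K using (1#) renaming (refl to ≈-refl; trans to ≈-trans)
  open FreeModule K
  open LinearForms K
  open BoolBialgebra K
  open TwistedBialgebras K BoolSp
  open BasedSpecies BoolSp using (B; _⊠_)

  restrict₂ : ∀ m → BoolFn (m ℕ.+ n) → BoolFn m × BoolFn n
  restrict₂ m f = restrictˡ m f , restrictʳ m f

  module _ (q₁ q₂ : ℤ) where
    private
      star₂ : BoolFn m × BoolFn n → BoolFn (m ℕ.+ n)
      star₂ = uncurry (star q₁ q₂)
      μ = starᴸ q₁ q₂

    isTwistedBialgebra : IsTwistedBialgebra μ unitᴸ Δᴸ εᴸ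
    isTwistedBialgebra = record
      { μ-linear = λ m n → mapᶠ-isLinear (m ⊠ n) (B (m ℕ.+ n)) star₂ (λ {x} {y} → star-cong q₁ q₂ {x} {y})
      ; Δ-linear = λ m n → mapᶠ-isLinear (B (m ℕ.+ n)) (m ⊠ n) (restrict₂ m)
          λ f≈g → (λ A → f≈g (A ++ ∅)) , (λ A → f≈g (∅ ++ A))
      ; ε-linear = ⟪⟫-isLinearForm (B 0) {φ = const 1#} (λ _ → ≈-refl)
      ; μ-equivariant = λ σ τ u → Eq-via-mapᶠ (B _)
          (star₂ ∘ Prod.map (actBool σ) (actBool τ)) (actBool (σ ⊕ τ) ∘ star₂) u
          (mapᶠ-∘ star₂ (Prod.map (actBool σ) (actBool τ)) u) (mapᶠ-∘ (actBool (σ ⊕ τ)) star₂ u)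
          λ (f , g) → star-act q₁ q₂ σ τ f g
      ; μ-assoc = λ m n p x y z → Eq-via-mapᶠ (B _)
          (star₂ ∘ Prod.map₁ star₂ ∘ Prod.assocˡ′) (actBool (assocF m n p) ∘ star₂ ∘ Prod.map₂ star₂) (x ⊗ (y ⊗ z))
          (mapᶠ-cong-∘ star₂ (Prod.map₁ star₂ ∘ Prod.assocˡ′) (x ⊗ (y ⊗ z))
            (≋-trans (mapᶠ-⊗ˡ star₂ (x ⊗ y) z)
              (mapᶠ-cong-∘ (Prod.map₁ star₂) Prod.assocˡ′ (x ⊗ (y ⊗ z)) (⊗-assoc x y z))))
          (mapᶠ-cong-∘ (actBool (assocF m n p)) (star₂ ∘ Prod.map₂ star₂) (x ⊗ (y ⊗ z))
            (mapᶠ-cong-∘ star₂ (Prod.map₂ star₂) (x ⊗ (y ⊗ z)) (mapᶠ-⊗ʳ star₂ x (y ⊗ z))))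
          λ (f , (g , h)) → star-assoc q₁ q₂ f g h
      ; μ-unitˡ = λ n x → Eq-via-mapᶠ (B n) (star₂ ∘ (oneBool ,_)) id x
          (mapᶠ-cong-∘ star₂ (oneBool ,_) x (basis-⊗ oneBool x)) (≋-sym (mapᶠ-id x)) (star-oneˡ q₁ q₂)
      ; μ-unitʳ = λ n x → Eq-via-mapᶠ (B _) (star₂ ∘ (_, oneBool)) (actBool (ridF n)) x
          (mapᶠ-cong-∘ star₂ (_, oneBool) x (⊗-basis x oneBool)) ≋-refl (star-oneʳ q₁ q₂)
      ; Δ-equivariant = λ {m} {m′} σ τ u → Eq-via-mapᶠ (m′ ⊠ _)
          (restrict₂ m′ ∘ actBool (σ ⊕ τ)) (Prod.map (actBool σ) (actBool τ) ∘ restrict₂ m) u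
          (mapᶠ-∘ (restrict₂ m′) (actBool (σ ⊕ τ)) u) (mapᶠ-∘ (Prod.map (actBool σ) (actBool τ)) (restrict₂ m) u)
          λ f → restrictˡ-act σ τ f , restrictʳ-act σ τ f
      ; Δ-coassoc = λ m n p u → Eq-via-mapᶠ (×-decSetoid (m ⊠ n) (B p))
          (Prod.map₁ (restrict₂ m) ∘ restrict₂ (m ℕ.+ n))
          (Prod.assocˡ′ ∘ Prod.map₂ (restrict₂ n) ∘ restrict₂ m ∘ actBool (↔-sym (assocF m n p))) u
          (≋-trans (⊗ᴸ-mapᶠ (Δᴸ m n) id (restrict₂ m) id (mapᶠ-basis (restrict₂ m)) (λ _ → ≋-refl) (Δᴸ (m ℕ.+ n) p u))
            (mapᶠ-∘ (Prod.map₁ (restrict₂ m)) (restrict₂ (m ℕ.+ n)) u))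
          (mapᶠ-cong-∘ Prod.assocˡ′ (Prod.map₂ (restrict₂ n) ∘ restrict₂ m ∘ actBool (↔-sym (assocF m n p))) u
            (≋-trans (⊗ᴸ-mapᶠ id (Δᴸ n p) id (restrict₂ n) (λ _ → ≋-refl) (mapᶠ-basis (restrict₂ n))
                       (Δᴸ m (n ℕ.+ p) (mapᶠ (actBool (↔-sym (assocF m n p))) u)))
              (mapᶠ-cong-∘ (Prod.map₂ (restrict₂ n)) (restrict₂ m ∘ actBool (↔-sym (assocF m n p))) u
                (mapᶠ-∘ (restrict₂ m) (actBool (↔-sym (assocF m n p))) u))))
          λ f → (restrictˡ-restrictˡ {m} {n} {p} f , restrictʳ-restrictˡ {m} {n} {p} f)
              , restrictʳ-restrictʳ {m} {n} {p} f
      ; Δ-counitˡ = λ n u → Eq-via-mapᶠ (B n) (proj₂ ∘ restrict₂ 0) id u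
          (≋-trans (linExt-·basis (εᴸ ∘ basis ∘ proj₁) proj₂ (⟪⟫-basis (const 1#) ∘ proj₁) (Δᴸ 0 n u))
            (mapᶠ-∘ proj₂ (restrict₂ 0) u))
          (≋-sym (mapᶠ-id u)) λ f A → refl
      ; Δ-counitʳ = λ n u → Eq-via-mapᶠ (B n) (proj₁ ∘ restrict₂ n ∘ actBool (ridF n)) id u
          (≋-trans (linExt-·basis (εᴸ ∘ basis ∘ proj₂) proj₁ (⟪⟫-basis (const 1#) ∘ proj₂)
                     (Δᴸ n 0 (mapᶠ (actBool (ridF n)) u)))
            (mapᶠ-cong-∘ proj₁ (restrict₂ n ∘ actBool (ridF n)) u (mapᶠ-∘ (restrict₂ n) (actBool (ridF n)) u)))
          (≋-sym (mapᶠ-id u)) restrictˡ-ridF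
      ; ε-multiplicative = λ x y → ≈-trans (⟪⟫-mapᶠ (const 1#) star₂ (x ⊗ y)) (⟪1⟫-⊗ x y)
      ; ε-unit = ⟪⟫-basis (const 1#) oneBool
      ; Δμ-compatible = λ a₁ a₂ b₁ b₂ x y → Eq-via-mapᶠ ((a₁ ℕ.+ b₁) ⊠ (a₂ ℕ.+ b₂))
          (restrict₂ (a₁ ℕ.+ b₁) ∘ actBool (mid4F a₁ a₂ b₁ b₂) ∘ star₂)
          (Prod.map star₂ star₂ ∘ shuffle4 ∘ Prod.map (restrict₂ a₁) (restrict₂ b₁)) (x ⊗ y)
          (mapᶠ-cong-∘ (restrict₂ (a₁ ℕ.+ b₁)) (actBool (mid4F a₁ a₂ b₁ b₂) ∘ star₂) (x ⊗ y)
            (mapᶠ-∘ (actBool (mid4F a₁ a₂ b₁ b₂)) star₂ (x ⊗ y)))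
          (≋-trans (⊗ᴸ-mapᶠ (μ a₁ b₁) (μ a₂ b₂) star₂ star₂ (mapᶠ-basis star₂) (mapᶠ-basis star₂)
                     (mapᶠ shuffle4 (Δᴸ a₁ a₂ x ⊗ Δᴸ b₁ b₂ y)))
            (mapᶠ-cong-∘ (Prod.map star₂ star₂) (shuffle4 ∘ Prod.map (restrict₂ a₁) (restrict₂ b₁)) (x ⊗ y)
              (mapᶠ-cong-∘ shuffle4 (Prod.map (restrict₂ a₁) (restrict₂ b₁)) (x ⊗ y)
                (mapᶠ-⊗ (restrict₂ a₁) (restrict₂ b₁) x y))))
          λ (f , g) → restrictˡ-star q₁ q₂ a₁ a₂ b₁ b₂ f g , restrictʳ-star q₁ q₂ a₁ a₂ b₁ b₂ f g
      }

    isCocommutativeTwistedBialgebra : IsCocommutativeTwistedBialgebra μ unitᴸ Δᴸ εᴸ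
    isCocommutativeTwistedBialgebra = record
      { isTwistedBialgebra = isTwistedBialgebra
      ; cocommutative = λ m n u → Eq-via-mapᶠ (n ⊠ m)
          (restrict₂ n ∘ actBool (swapF m n)) (Prod.swap ∘ restrict₂ m) u
          (mapᶠ-∘ (restrict₂ n) (actBool (swapF m n)) u) (mapᶠ-∘ Prod.swap (restrict₂ m) u)
          λ f → restrictˡ-swapF {m} f , restrictʳ-swapF {m} f
      }

  module _ (q q₁ q₂ : ℤ) where
    private
      θ = thetaᴸ q
      θ⁻¹ = thetaᴸ (- q)

      θ-isLinear : ∀ q n → IsLinear (B n) (B n) (thetaᴸ q n)
      θ-isLinear q n = mapᶠ-isLinear (B n) (B n) (theta q) (λ {f} {g} → theta-cong q {f} {g})

      θ⁻¹∘θ : ∀ n u → Eq (B n) (θ⁻¹ n (θ n u)) u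
      θ⁻¹∘θ n u = Eq-via-mapᶠ (B n) (theta (- q) ∘ theta q) id u
        (mapᶠ-∘ (theta (- q)) (theta q) u) (≋-sym (mapᶠ-id u)) (theta-inverse q)

      θ∘θ⁻¹ : ∀ n u → Eq (B n) (θ n (θ⁻¹ n u)) u
      θ∘θ⁻¹ n u = Eq-via-mapᶠ (B n) (theta q ∘ theta (- q)) id u
        (mapᶠ-∘ (theta q) (theta (- q)) u) (≋-sym (mapᶠ-id u)) (theta-inverseʳ q)

    theta-isTwistedBialgebraIso :
      IsTwistedBialgebraIso (starᴸ q₁ q₂) unitᴸ Δᴸ εᴸ (starᴸ (q₁ + q) (q₂ + q)) unitᴸ Δᴸ εᴸ θ
    theta-isTwistedBialgebraIso = record
      { Φ-linear = θ-isLinear q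
      ; Φ-equivariant = λ {m} {n} σ u → Eq-via-mapᶠ (B n)
          (theta q ∘ actBool σ) (actBool σ ∘ theta q) u
          (mapᶠ-∘ (theta q) (actBool σ) u) (mapᶠ-∘ (actBool σ) (theta q) u) (theta-act q σ)
      ; Φ-injective = λ n → leftInverse⇒injective (B n) (B n) {θ n} (θ-isLinear (- q) n) (θ⁻¹∘θ n)
      ; Φ-surjective = λ n v → θ⁻¹ n v , θ∘θ⁻¹ n v
      ; Φ-μ = λ m n x y → Eq-via-mapᶠ (B (m ℕ.+ n))
          (theta q ∘ uncurry (star q₁ q₂)) (uncurry (star (q₁ + q) (q₂ + q)) ∘ Prod.map (theta q) (theta q)) (x ⊗ y)
          (mapᶠ-∘ (theta q) (uncurry (star q₁ q₂)) (x ⊗ y))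
          (mapᶠ-cong-∘ (uncurry (star (q₁ + q) (q₂ + q))) (Prod.map (theta q) (theta q)) (x ⊗ y)
            (mapᶠ-⊗ (theta q) (theta q) x y))
          λ (f , g) → theta-star q q₁ q₂ f g
      ; Φ-unit = Eq-via-mapᶠ (B 0) (theta q) id unitᴸ ≋-refl (≋-sym (mapᶠ-id unitᴸ)) (theta-on-∅ q)
      ; Φ-Δ = λ m n u → Eq-via-mapᶠ (m ⊠ n)
          (restrict₂ m ∘ theta q) (Prod.map (theta q) (theta q) ∘ restrict₂ m) u
          (mapᶠ-∘ (restrict₂ m) (theta q) u)
          (≋-trans (⊗ᴸ-mapᶠ (θ m) (θ n) (theta q) (theta q) (mapᶠ-basis (theta q)) (mapᶠ-basis (theta q))
                     (Δᴸ m n u))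
            (mapᶠ-∘ (Prod.map (theta q) (theta q)) (restrict₂ m) u))
          λ f → theta-restrictˡ q m f , theta-restrictʳ q m f
      ; Φ-ε = ⟪⟫-mapᶠ (const 1#) (theta q)
      }

theorem2p19 : ∀ {c ℓ} (K : Field c ℓ) →
    let open BoolBialgebra K
        open TwistedBialgebras K BoolSp
    in (∀ (q₁ q₂ : ℤ) →
          IsCocommutativeTwistedBialgebra (starᴸ q₁ q₂) unitᴸ Δᴸ εᴸ)
       × (∀ (q q₁ q₂ : ℤ) →
          IsTwistedBialgebraIso (starᴸ q₁ q₂) unitᴸ Δᴸ εᴸ
            (starᴸ (q₁ + q) (q₂ + q)) unitᴸ Δᴸ εᴸ (thetaᴸ q))
theorem2p19 K = isCocommutativeTwistedBialgebra , theta-isTwistedBialgebraIso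
  where open BoolBialgebraProofs K
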